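{- The only topographical groups which are normal subgroups of $\Pi=\mathrm{PGL}_2(\mathbb{Z})$ are $G:=\Gamma^3=\langle\gamma_1,\gamma_2,\gamma_3\rangle$ and $P:=\Pi(2)=\langle\rho_1,\rho_2,\rho_3\rangle$, where $$\gamma_1=\begin{pmatrix}-1&2\\-1&1\end{pmatrix},\ \gamma_2=\begin{pmatrix}1&-1\\2&-1\end{pmatrix},\ \gamma_3=\begin{pmatrix}0&1\\-1&0\end{pmatrix},\ \rho_1=\begin{pmatrix}-1&0\\0&1\end{pmatrix},\ \rho_2=\begin{pmatrix}-1&2\\0&1\end{pmatrix},\ \rho_3=\begin{pmatrix}-1&0\\2&1\end{pmatrix}.$$
   Context: $\Gamma=\mathrm{PSL}_2(\mathbb{Z})$; $\Gamma^3$ is the subgroup of $\Gamma$ generated by cubes of elements of $\Gamma$; $\Pi(2)$ is the principal congruence subgroup of level $2$ of $\Pi=\mathrm{PGL}_2(\mathbb{Z})$ (kernel of reduction mod $2$). A superbasis is an unordered triple $\{a,b,c\}$ of points of $\widehat{\mathbb{Q}}=\mathbb{P}^1(\mathbb{Q})$ such that, writing them in lowest terms $a=a_1/a_2$, etc., each pair of the corresponding primitive vectors forms a basis of $\mathbb{Z}^2$. Conway's topograph is the graph whose vertices are superbases, two being adjacent when they share two of their three elements (it is a tree of valence three). Let $\phi:\Pi\to\{\text{superbases}\}$ send a matrix with columns $(a_1,a_2)^t,(b_1,b_2)^t$ to $\{a_1/a_2,\ b_1/b_2,\ (a_1+b_1)/(a_2+b_2)\}$. A topographical group is a subgroup $H<\Pi$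 such that, for a suitable generating set $S$ of $H$, $\phi$ restricts to a graph isomorphism from the right-multiplication Cayley graph of $(H,S)$ (vertices $H$, edges $\{h,hs\}$, $s\in S$) onto Conway's topograph. -}

module Defs where

open import Data.Integer using (ℤ; +_; -[1+_]; _+_; _*_; -_; _-_)
open import Data.Product using (Σ; ∃; _×_; _,_)
open import Data.Sum using (_⊎_)
open import Relation.Nullary using (¬_)
open import Relation.Binary.PropositionalEquality using (_≡_)

record Mat : Set where
  constructor mat
  field
    a b c d : ℤ
open Mat public

det : Mat → ℤ
det (mat a b c d) = a * d - b * c

_⊗_ : Mat → Mat → Mat
mat a b c d ⊗ mat a' b' c' d' =
  mat (a * a' + b * c') (a * b' + b * d') (c * a' + d * c') (c * b' + d * d')
infixl 7 _⊗_

negM : Mat → Mat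
negM (mat a b c d) = mat (- a) (- b) (- c) (- d)

I : Mat
I = mat (+ 1) (+ 0) (+ 0) (+ 1)

-- inverse in GL₂(ℤ): det · adj (valid since det = ±1 ⇒ det⁻¹ = det)
inv : Mat → Mat
inv M@(mat a b c d) = mat (det M * d) (det M * (- b)) (det M * (- c)) (det M * a)

-- Π = PGL₂(ℤ): matrices of determinant ±1, modulo ±I
InΠ : Mat → Set
InΠ M = (det M ≡ + 1) ⊎ (det M ≡ -[1+ 0 ])

_~_ : Mat → Mat → Set
M ~ N = (M ≡ N) ⊎ (M ≡ negM N)

-- subgroups of Π (as predicates on representatives, closed under ~)

record IsSubgroup (H : Mat → Set) : Set where
  field
    ⊆Π      : ∀ {M} → H M → InΠ M
    resp    : ∀ {M N} → M ~ N → H M → H N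
    has-id  : H I
    mul     : ∀ {M N} → H M → H N → H (M ⊗ N)
    has-inv : ∀ {M} → H M → H (inv M)

IsNormal : (Mat → Set) → Set
IsNormal H = ∀ {g h} → InΠ g → H h → H (g ⊗ h ⊗ inv g)

data Gen (S : Mat → Set) : Mat → Set where
  gen-id  : Gen S I
  gen-mul : ∀ {M s} → Gen S M → S s → Gen S (M ⊗ s)
  gen-inv : ∀ {M s} → Gen S M → S s → Gen S (M ⊗ inv s)
  gen-resp : ∀ {M N} → M ~ N → Gen S M → Gen S N

_≐_ : (Mat → Set) → (Mat → Set) → Set
H ≐ K = ∀ M → (H M → K M) × (K M → H M)

record V2 : Set where
  constructor v2
  field
    x y : ℤ

negV : V2 → V2
negV (v2 x y) = v2 (- x) (- y)

_⊕_ : V2 → V2 → V2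
v2 x y ⊕ v2 x' y' = v2 (x + x') (y + y')

det2 : V2 → V2 → ℤ
det2 (v2 x y) (v2 x' y') = x * y' - x' * y

-- two primitive vectors represent the same point of ℙ¹(ℚ) iff equal up to sign
_≈P_ : V2 → V2 → Set
u ≈P v = (u ≡ v) ⊎ (u ≡ negV v)

IsBasis : V2 → V2 → Set
IsBasis u v = (det2 u v ≡ + 1) ⊎ (det2 u v ≡ -[1+ 0 ])

-- a triple of (primitive) vectors, read as the unordered triple of points
record Triple : Set where
  constructor tri
  field
    p₁ p₂ p₃ : V2
open Triple public

IsSuperbasis : Triple → Set
IsSuperbasis (tri u v w) = IsBasis u v × IsBasis v w × IsBasis u w

_∈T_ : V2 → Triple → Set
p ∈T tri u v w = (p ≈P u) ⊎ (p ≈P v) ⊎ (p ≈P w)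

_≈T_ : Triple → Triple → Set
T ≈T T' = ∀ p → (p ∈T T → p ∈T T') × (p ∈T T' → p ∈T T)

Adj : Triple → Triple → Set
Adj T T' = ¬ (T ≈T T') ×
  Σ V2 λ p → Σ V2 λ q → ¬ (p ≈P q) ×
    (p ∈T T) × (p ∈T T') × (q ∈T T) × (q ∈T T')

φ : Mat → Triple
φ (mat a b c d) = tri (v2 a c) (v2 b d) (v2 a c ⊕ v2 b d)

CayleyEdge : (Mat → Set) → Mat → Mat → Set
CayleyEdge S h h' = Σ Mat λ s → S s × ((h' ~ (h ⊗ s)) ⊎ (h ~ (h' ⊗ s)))

record IsTopographical (H : Mat → Set) : Set₁ where
  field
    S          : Mat → Set
    S⊆H        : ∀ {s} → S s → H s
    generates  : ∀ {M} → H M → Gen S M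
    injective  : ∀ {h h'} → H h → H h' → φ h ≈T φ h' → h ~ h'
    surjective : ∀ T → IsSuperbasis T → Σ Mat λ h → H h × (φ h ≈T T)
    edges⇒adj  : ∀ {h h'} → H h → H h' → CayleyEdge S h h' → Adj (φ h) (φ h')
    adj⇒edges  : ∀ {h h'} → H h → H h' → Adj (φ h) (φ h') → CayleyEdge S h h'

-1ℤ : ℤ
-1ℤ = -[1+ 0 ]

γ₁ γ₂ γ₃ ρ₁ ρ₂ ρ₃ : Mat
γ₁ = mat -1ℤ (+ 2) -1ℤ (+ 1)
γ₂ = mat (+ 1) -1ℤ (+ 2) -1ℤ
γ₃ = mat (+ 0) (+ 1) -1ℤ (+ 0)
ρ₁ = mat -1ℤ (+ 0) (+ 0) (+ 1)
ρ₂ = mat -1ℤ (+ 2) (+ 0) (+ 1)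
ρ₃ = mat -1ℤ (+ 0) (+ 2) (+ 1)

Sγ : Mat → Set
Sγ M = (M ≡ γ₁) ⊎ (M ≡ γ₂) ⊎ (M ≡ γ₃)

Sρ : Mat → Set
Sρ M = (M ≡ ρ₁) ⊎ (M ≡ ρ₂) ⊎ (M ≡ ρ₃)

G P : Mat → Set
G = Gen Sγ
P = Gen Sρ

{-# OPTIONS --safe #-}
module Submission where

-- Π acts on superbases, and φ M is the image under M of the base superbasis T₀ = {e₁, e₂, e₁ + e₂}.
-- Its stabiliser is a copy Σ of S₃ (six matrices σ), and the three neighbours of T₀ in the topograph
-- are the images of T₀ under γ₁, γ₂, γ₃. Hence a subgroup K is topographical as soon as it meets
-- every coset of Σ exactly once, the edges at h being h ⊗ s for the elements s of K lying in the
-- three cosets γ n Σ.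
--   For K = G or P the subgroup is normal, because conjugating its generators by the elementary
-- matrices (which generate Π, by the Euclidean algorithm) stays in K; so K Σ is a group containing
-- the elementary matrices, i.e. all of Π, and K meets every coset. A congruence invariant (modulo 3,
-- respectively modulo 2) shows K ∩ Σ = 1, so it meets each coset only once.
--   Conversely, a normal topographical H contains an element c of the coset γ₃ Σ. Unless c is γ₃
-- or ρ₁ (up to sign), the product of c with a suitable Σ-conjugate of c is a nontrivial element of H
-- fixing T₀, contradicting injectivity. In the two remaining cases
-- normality puts the Σ-conjugates of γ₃ (respectively ρ₁) into H; they form the edge set of G
-- (respectively P), and a topographical group is generated by its edges at the identity, so H is G
-- (respectively P).

open import Data.Empty using (⊥-elim)
open import Data.Fin using (Fin; zero; suc; #_)
open import Data.Fin.Properties using (all?; any?) renaming (_≟_ to _≟F_)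
open import Data.Integer using (ℤ; +_; -[1+_]; _+_; _*_; -_; _-_; ∣_∣; _⊖_)
open import Data.Integer.Divisibility.Signed using (_∣_; _∣?_; ∣m∣n⇒∣m+n; ∣m⇒∣-m; ∣m⇒∣m*n)
import Data.Integer.Properties as ℤ
open import Data.Integer.Tactic.RingSolver using (solve-∀)
open import Data.List using (List; _∷_; []; foldl)
open import Data.Nat as ℕ using (zero; suc; _<_; _≤_; s≤s; _≤?_)
import Data.Nat.Properties as ℕ
open import Data.Product using (Σ; ∃; _×_; _,_; proj₁; proj₂; uncurry)
open import Data.Sum using (_⊎_; inj₁; inj₂)
open import Data.Vec using (_∷_; []; lookup)
open import Function using (_∘_)
open import Level using (0ℓ)
open import Relation.Binary.Bundles using (Setoid)
open import Relation.Binary.PropositionalEquality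
  using (_≡_; _≢_; refl; sym; trans; cong; cong₂; subst; subst₂; module ≡-Reasoning)
import Relation.Binary.Reasoning.Setoid as SetoidReasoning
open import Relation.Nullary using (¬_; Dec; yes; no)
open import Relation.Nullary.Decidable using (_⊎-dec_; _×-dec_; _→-dec_; ¬?; map′; from-yes)

open import Defs

IsUnit : ℤ → Set
IsUnit z = (z ≡ + 1) ⊎ (z ≡ -1ℤ)

unit-* : ∀ {x y} → IsUnit x → IsUnit y → IsUnit (x * y)
unit-* (inj₁ refl) (inj₁ refl) = inj₁ refl
unit-* (inj₁ refl) (inj₂ refl) = inj₂ refl
unit-* (inj₂ refl) (inj₁ refl) = inj₂ refl
unit-* (inj₂ refl) (inj₂ refl) = inj₁ refl

unit-neg : ∀ {x} → IsUnit x → IsUnit (- x)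
unit-neg (inj₁ refl) = inj₂ refl
unit-neg (inj₂ refl) = inj₁ refl

unit-square : ∀ {x} → IsUnit x → x * x ≡ + 1
unit-square (inj₁ refl) = refl
unit-square (inj₂ refl) = refl

∣x∣≡1⇒unit : ∀ {x} → ∣ x ∣ ≡ 1 → IsUnit x
∣x∣≡1⇒unit {+ 1} refl = inj₁ refl
∣x∣≡1⇒unit { -[1+ 0 ]} refl = inj₂ refl

unit⇒∣x∣≡1 : ∀ {x} → IsUnit x → ∣ x ∣ ≡ 1
unit⇒∣x∣≡1 (inj₁ refl) = refl
unit⇒∣x∣≡1 (inj₂ refl) = refl

unit⇒≢0 : ∀ {x} → IsUnit x → x ≢ + 0
unit⇒≢0 (inj₁ refl) ()
unit⇒≢0 (inj₂ refl) ()

mat-cong : ∀ {a b c d a′ b′ c′ d′} →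
  a ≡ a′ → b ≡ b′ → c ≡ c′ → d ≡ d′ → mat a b c d ≡ mat a′ b′ c′ d′
mat-cong refl refl refl refl = refl

⊗-assoc : ∀ A B C → (A ⊗ B) ⊗ C ≡ A ⊗ (B ⊗ C)
⊗-assoc (mat a b c d) (mat e f g h) (mat i j k l) =
  mat-cong (entry a b e f g h i k) (entry a b e f g h j l) (entry c d e f g h i k) (entry c d e f g h j l)
  where
  entry : ∀ x y e f g h p q →
    (x * e + y * g) * p + (x * f + y * h) * q ≡ x * (e * p + f * q) + y * (g * p + h * q)
  entry = solve-∀

⊗-identityˡ : ∀ A → I ⊗ A ≡ A
⊗-identityˡ (mat a b c d) = mat-cong (first a c) (first b d) (second a c) (second b d)
  where
  first : ∀ x y → + 1 * x + + 0 * y ≡ x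
  first = solve-∀
  second : ∀ x y → + 0 * x + + 1 * y ≡ y
  second = solve-∀

⊗-identityʳ : ∀ A → A ⊗ I ≡ A
⊗-identityʳ (mat a b c d) = mat-cong (first a b) (second a b) (first c d) (second c d)
  where
  first : ∀ x y → x * + 1 + y * + 0 ≡ x
  first = solve-∀
  second : ∀ x y → x * + 0 + y * + 1 ≡ y
  second = solve-∀

negM-involutive : ∀ A → negM (negM A) ≡ A
negM-involutive (mat a b c d) =
  mat-cong (ℤ.neg-involutive a) (ℤ.neg-involutive b) (ℤ.neg-involutive c) (ℤ.neg-involutive d)

negM-⊗ : ∀ A B → negM A ⊗ B ≡ negM (A ⊗ B)
negM-⊗ (mat a b c d) (mat e f g h) = mat-cong (entry a b e g) (entry a b f h) (entry c d e g) (entry c d f h)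
  where
  entry : ∀ x y p q → (- x) * p + (- y) * q ≡ - (x * p + y * q)
  entry = solve-∀

⊗-negM : ∀ A B → A ⊗ negM B ≡ negM (A ⊗ B)
⊗-negM (mat a b c d) (mat e f g h) = mat-cong (entry a b e g) (entry a b f h) (entry c d e g) (entry c d f h)
  where
  entry : ∀ x y p q → x * (- p) + y * (- q) ≡ - (x * p + y * q)
  entry = solve-∀

det-⊗ : ∀ A B → det (A ⊗ B) ≡ det A * det B
det-⊗ (mat a b c d) (mat e f g h) = identity a b c d e f g h
  where
  identity : ∀ a b c d e f g h →
    (a * e + b * g) * (c * f + d * h) - (a * f + b * h) * (c * e + d * g) ≡ (a * d - b * c) * (e * h - f * g)
  identity = solve-∀

det-inv : ∀ A → det (inv A) ≡ det A * det A * det A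
det-inv (mat a b c d) = identity a b c d
  where
  identity : ∀ a b c d → let δ = a * d - b * c in
    (δ * d) * (δ * a) - (δ * (- b)) * (δ * (- c)) ≡ δ * δ * δ
  identity = solve-∀

det-negM : ∀ A → det (negM A) ≡ det A
det-negM (mat a b c d) = identity a b c d
  where
  identity : ∀ a b c d → (- a) * (- d) - (- b) * (- c) ≡ a * d - b * c
  identity = solve-∀

InΠ-⊗ : ∀ A B → InΠ A → InΠ B → InΠ (A ⊗ B)
InΠ-⊗ A B u v = subst IsUnit (sym (det-⊗ A B)) (unit-* {det A} {det B} u v)

InΠ-inv : ∀ A → InΠ A → InΠ (inv A)
InΠ-inv A u = subst IsUnit (sym (det-inv A)) (unit-* {det A * det A} {det A} (unit-* {det A} {det A} u u) u)

InΠ-negM : ∀ A → InΠ A → InΠ (negM A)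
InΠ-negM A u = subst IsUnit (sym (det-negM A)) u

-- A ⊗ inv A is the scalar matrix (det A)², which is I exactly on Π.
⊗-inverseʳ : ∀ A → InΠ A → A ⊗ inv A ≡ I
⊗-inverseʳ (mat a b c d) u = mat-cong
  (trans (upper-left a b c d) (unit-square u)) (upper-right a b c d)
  (lower-left a b c d) (trans (lower-right a b c d) (unit-square u))
  where
  upper-left : ∀ a b c d → a * ((a * d - b * c) * d) + b * ((a * d - b * c) * (- c)) ≡ (a * d - b * c) * (a * d - b * c)
  upper-left = solve-∀
  upper-right : ∀ a b c d → a * ((a * d - b * c) * (- b)) + b * ((a * d - b * c) * a) ≡ + 0
  upper-right = solve-∀
  lower-left : ∀ a b c d → c * ((a * d - b * c) * d) + d * ((a * d - b * c) * (- c)) ≡ + 0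
  lower-left = solve-∀
  lower-right : ∀ a b c d → c * ((a * d - b * c) * (- b)) + d * ((a * d - b * c) * a) ≡ (a * d - b * c) * (a * d - b * c)
  lower-right = solve-∀

inverse-unique : ∀ {X} A → InΠ A → X ⊗ A ≡ I → X ≡ inv A
inverse-unique {X} A u XA≡I = begin
  X                   ≡⟨ sym (⊗-identityʳ X) ⟩
  X ⊗ I               ≡⟨ cong (X ⊗_) (sym (⊗-inverseʳ A u)) ⟩
  X ⊗ (A ⊗ inv A)     ≡⟨ sym (⊗-assoc X A (inv A)) ⟩
  X ⊗ A ⊗ inv A       ≡⟨ cong (_⊗ inv A) XA≡I ⟩
  I ⊗ inv A           ≡⟨ ⊗-identityˡ (inv A) ⟩
  inv A               ∎
  where open ≡-Reasoning

inv-involutive : ∀ A → InΠ A → inv (inv A) ≡ A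
inv-involutive A u = sym (inverse-unique (inv A) (InΠ-inv A u) (⊗-inverseʳ A u))

⊗-inverseˡ : ∀ A → InΠ A → inv A ⊗ A ≡ I
⊗-inverseˡ A u = subst (λ X → inv A ⊗ X ≡ I) (inv-involutive A u) (⊗-inverseʳ (inv A) (InΠ-inv A u))

inv-⊗ : ∀ A B → InΠ A → InΠ B → inv (A ⊗ B) ≡ inv B ⊗ inv A
inv-⊗ A B u v = sym (inverse-unique (A ⊗ B) (InΠ-⊗ A B u v) (begin
  inv B ⊗ inv A ⊗ (A ⊗ B)     ≡⟨ ⊗-assoc (inv B) (inv A) (A ⊗ B) ⟩
  inv B ⊗ (inv A ⊗ (A ⊗ B))   ≡⟨ cong (inv B ⊗_) (sym (⊗-assoc (inv A) A B)) ⟩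
  inv B ⊗ (inv A ⊗ A ⊗ B)     ≡⟨ cong (λ X → inv B ⊗ (X ⊗ B)) (⊗-inverseˡ A u) ⟩
  inv B ⊗ (I ⊗ B)             ≡⟨ cong (inv B ⊗_) (⊗-identityˡ B) ⟩
  inv B ⊗ B                   ≡⟨ ⊗-inverseˡ B v ⟩
  I                           ∎))
  where open ≡-Reasoning

inv-negM : ∀ A → InΠ A → inv (negM A) ≡ negM (inv A)
inv-negM A u = sym (inverse-unique (negM A) (InΠ-negM A u) (begin
  negM (inv A) ⊗ negM A       ≡⟨ negM-⊗ (inv A) (negM A) ⟩
  negM (inv A ⊗ negM A)       ≡⟨ cong negM (⊗-negM (inv A) A) ⟩
  negM (negM (inv A ⊗ A))     ≡⟨ negM-involutive (inv A ⊗ A) ⟩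
  inv A ⊗ A                   ≡⟨ ⊗-inverseˡ A u ⟩
  I                           ∎))
  where open ≡-Reasoning

~-refl : ∀ {A} → A ~ A
~-refl = inj₁ refl

~-sym : ∀ {A B} → A ~ B → B ~ A
~-sym (inj₁ refl) = inj₁ refl
~-sym {B = B} (inj₂ refl) = inj₂ (sym (negM-involutive B))

~-trans : ∀ {A B C} → A ~ B → B ~ C → A ~ C
~-trans (inj₁ refl) B~C = B~C
~-trans (inj₂ refl) (inj₁ refl) = inj₂ refl
~-trans (inj₂ refl) (inj₂ refl) = inj₁ (negM-involutive _)

⊗-congʳ : ∀ {A B} C → A ~ B → (A ⊗ C) ~ (B ⊗ C)
⊗-congʳ C (inj₁ refl) = inj₁ refl
⊗-congʳ {B = B} C (inj₂ refl) = inj₂ (negM-⊗ B C)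

⊗-congˡ : ∀ {A B} C → A ~ B → (C ⊗ A) ~ (C ⊗ B)
⊗-congˡ C (inj₁ refl) = inj₁ refl
⊗-congˡ {B = B} C (inj₂ refl) = inj₂ (⊗-negM C B)

InΠ-resp : ∀ {A B} → A ~ B → InΠ A → InΠ B
InΠ-resp (inj₁ refl) u = u
InΠ-resp {B = B} (inj₂ refl) u = subst InΠ (negM-involutive B) (InΠ-negM (negM B) u)

inv-cong : ∀ {A B} → InΠ A → A ~ B → inv A ~ inv B
inv-cong u (inj₁ refl) = inj₁ refl
inv-cong {B = B} u (inj₂ refl) = inj₂ (inv-negM B (InΠ-resp {negM B} {B} (inj₂ refl) u))

quotient-~ : ∀ h {h′ k} → InΠ h → (inv h ⊗ h′) ~ k → h′ ~ (h ⊗ k)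
quotient-~ h {h′} u h⁻¹h′~k = subst (_~ (h ⊗ _)) h⊗h⁻¹h′≡h′ (⊗-congˡ h h⁻¹h′~k)
  where
  h⊗h⁻¹h′≡h′ : h ⊗ (inv h ⊗ h′) ≡ h′
  h⊗h⁻¹h′≡h′ = trans (sym (⊗-assoc h (inv h) h′)) (trans (cong (_⊗ h′) (⊗-inverseʳ h u)) (⊗-identityˡ h′))

_≟M_ : (A B : Mat) → Dec (A ≡ B)
mat a b c d ≟M mat a′ b′ c′ d′ =
  map′ (λ (ea , eb , ec , ed) → mat-cong ea eb ec ed) (λ e → cong Mat.a e , cong Mat.b e , cong Mat.c e , cong Mat.d e)
       ((a ℤ.≟ a′) ×-dec (b ℤ.≟ b′) ×-dec (c ℤ.≟ c′) ×-dec (d ℤ.≟ d′))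

_~?_ : (A B : Mat) → Dec (A ~ B)
A ~? B = (A ≟M B) ⊎-dec (A ≟M negM B)

InΠ? : (A : Mat) → Dec (InΠ A)
InΠ? A = (det A ℤ.≟ + 1) ⊎-dec (det A ℤ.≟ -1ℤ)

Gen-⊗ : ∀ {S A B} → Gen S A → Gen S B → Gen S (A ⊗ B)
Gen-⊗ {A = A} gA gen-id = subst (Gen _) (sym (⊗-identityʳ A)) gA
Gen-⊗ {A = A} gA (gen-mul {M} {s} gM s∈S) = subst (Gen _) (⊗-assoc A M s) (gen-mul (Gen-⊗ gA gM) s∈S)
Gen-⊗ {A = A} gA (gen-inv {M} {s} gM s∈S) = subst (Gen _) (⊗-assoc A M (inv s)) (gen-inv (Gen-⊗ gA gM) s∈S)
Gen-⊗ {A = A} gA (gen-resp M~N gM) = gen-resp (⊗-congˡ A M~N) (Gen-⊗ gA gM)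

Gen-generator : ∀ {S s} → S s → Gen S s
Gen-generator {S} {s} s∈S = subst (Gen S) (⊗-identityˡ s) (gen-mul gen-id s∈S)

module _ {S : Mat → Set} (S⊆Π : ∀ {s} → S s → InΠ s) where

  Gen⊆Π : ∀ {M} → Gen S M → InΠ M
  Gen⊆Π gen-id = inj₁ refl
  Gen⊆Π (gen-mul {M} {s} gM s∈S) = InΠ-⊗ M s (Gen⊆Π gM) (S⊆Π s∈S)
  Gen⊆Π (gen-inv {M} {s} gM s∈S) = InΠ-⊗ M (inv s) (Gen⊆Π gM) (InΠ-inv s (S⊆Π s∈S))
  Gen⊆Π (gen-resp M~N gM) = InΠ-resp M~N (Gen⊆Π gM)

  Gen-inv : ∀ {M} → Gen S M → Gen S (inv M)
  Gen-inv gen-id = gen-id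
  Gen-inv (gen-mul {M} {s} gM s∈S) =
    subst (Gen S) (sym (inv-⊗ M s (Gen⊆Π gM) (S⊆Π s∈S))) (Gen-⊗ generator⁻¹ (Gen-inv gM))
    where
    generator⁻¹ : Gen S (inv s)
    generator⁻¹ = subst (Gen S) (⊗-identityˡ (inv s)) (gen-inv gen-id s∈S)
  Gen-inv (gen-inv {M} {s} gM s∈S) =
    subst (Gen S) (sym (trans (inv-⊗ M (inv s) (Gen⊆Π gM) (InΠ-inv s (S⊆Π s∈S)))
                              (cong (_⊗ inv M) (inv-involutive s (S⊆Π s∈S)))))
          (Gen-⊗ (Gen-generator s∈S) (Gen-inv gM))
  Gen-inv (gen-resp M~N gM) = gen-resp (inv-cong (Gen⊆Π gM) M~N) (Gen-inv gM)

  Gen-isSubgroup : IsSubgroup (Gen S)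
  Gen-isSubgroup = record
    { ⊆Π = Gen⊆Π ; resp = gen-resp ; has-id = gen-id ; mul = Gen-⊗ ; has-inv = Gen-inv }

Gen-least : ∀ {S H} → IsSubgroup H → (∀ {s} → S s → H s) → ∀ {M} → Gen S M → H M
Gen-least H-subgroup S⊆H gen-id = IsSubgroup.has-id H-subgroup
Gen-least H-subgroup S⊆H (gen-mul gM s∈S) = IsSubgroup.mul H-subgroup (Gen-least H-subgroup S⊆H gM) (S⊆H s∈S)
Gen-least H-subgroup S⊆H (gen-inv gM s∈S) =
  IsSubgroup.mul H-subgroup (Gen-least H-subgroup S⊆H gM) (IsSubgroup.has-inv H-subgroup (S⊆H s∈S))
Gen-least H-subgroup S⊆H (gen-resp M~N gM) = IsSubgroup.resp H-subgroup M~N (Gen-least H-subgroup S⊆H gM)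

Gen-mono : ∀ {S S′} → (∀ {s} → S s → S′ s) → ∀ {M} → Gen S M → Gen S′ M
Gen-mono S⊆S′ gen-id = gen-id
Gen-mono S⊆S′ (gen-mul gM s∈S) = gen-mul (Gen-mono S⊆S′ gM) (S⊆S′ s∈S)
Gen-mono S⊆S′ (gen-inv gM s∈S) = gen-inv (Gen-mono S⊆S′ gM) (S⊆S′ s∈S)
Gen-mono S⊆S′ (gen-resp M~N gM) = gen-resp M~N (Gen-mono S⊆S′ gM)

≐-sym : ∀ {H K} → H ≐ K → K ≐ H
≐-sym H≐K M = proj₂ (H≐K M) , proj₁ (H≐K M)

≐-trans : ∀ {H K L} → H ≐ K → K ≐ L → H ≐ L
≐-trans H≐K K≐L M = (λ HM → proj₁ (K≐L M) (proj₁ (H≐K M) HM)) , (λ LM → proj₂ (H≐K M) (proj₂ (K≐L M) LM))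

Gen-≐ : ∀ {S S′} → (∀ {s} → S s → S′ s) → (∀ {s} → S′ s → S s) → Gen S ≐ Gen S′
Gen-≐ S⊆S′ S′⊆S M = Gen-mono S⊆S′ , Gen-mono S′⊆S

OneOf : ∀ {n} → (Fin n → Mat) → Mat → Set
OneOf f M = ∃ λ i → M ≡ f i

product : ∀ {n} → (Fin n → Mat) → List (Fin n) → Mat
product f = foldl (λ M t → M ⊗ f t) I

Gen-word : ∀ {n} (f : Fin n → Mat) w {M} → product f w ~ M → Gen (OneOf f) M
Gen-word f w w~M = gen-resp w~M (Gen-foldl gen-id w)
  where
  Gen-foldl : ∀ {M} → Gen (OneOf f) M → ∀ w → Gen (OneOf f) (foldl (λ M t → M ⊗ f t) M w)
  Gen-foldl gM [] = gM
  Gen-foldl gM (t ∷ w) = Gen-foldl (gen-mul gM (t , refl)) w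

-- The Euclidean algorithm: Π is generated by the elementary matrices

shear swap : Mat
shear = mat (+ 1) (+ 1) (+ 0) (+ 1)
swap = mat (+ 0) (+ 1) (+ 1) (+ 0)

elementary : Fin 3 → Mat
elementary = lookup (shear ∷ swap ∷ ρ₁ ∷ [])

Elementary : Mat → Set
Elementary = OneOf elementary

elementary∈Π : ∀ e → InΠ (elementary e)
elementary∈Π zero = inj₁ refl
elementary∈Π (suc zero) = inj₂ refl
elementary∈Π (suc (suc zero)) = inj₂ refl

∣1+m⊖1+n∣<1+n : ∀ {m n} → m ≤ n → ∣ suc m ⊖ suc n ∣ < suc n
∣1+m⊖1+n∣<1+n {m} {n} m≤n = subst (_< suc n) (sym (ℤ.∣⊖∣-≤ (s≤s m≤n))) (s≤s (ℕ.m∸n≤m n m))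

∣1+n⊖1+m∣<1+n : ∀ {m n} → m ≤ n → ∣ suc n ⊖ suc m ∣ < suc n
∣1+n⊖1+m∣<1+n {m} {n} m≤n = subst (_< suc n) (ℤ.∣m⊖n∣≡∣n⊖m∣ (suc m) (suc n)) (∣1+m⊖1+n∣<1+n m≤n)

shrink : ∀ x y → x ≢ + 0 → ∣ x ∣ ≤ ∣ y ∣ → (∣ y + x ∣ < ∣ y ∣) ⊎ (∣ y - x ∣ < ∣ y ∣)
shrink (+ zero)  y         x≢0 _         = ⊥-elim (x≢0 refl)
shrink (+ suc m) (+ suc n) _   (s≤s m≤n) = inj₂ (∣1+n⊖1+m∣<1+n m≤n)
shrink (+ suc m) -[1+ n ]  _   (s≤s m≤n) = inj₁ (∣1+m⊖1+n∣<1+n m≤n)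
shrink -[1+ m ]  (+ suc n) _   (s≤s m≤n) = inj₁ (∣1+n⊖1+m∣<1+n m≤n)
shrink -[1+ m ]  -[1+ n ]  _   (s≤s m≤n) = inj₂ (∣1+m⊖1+n∣<1+n m≤n)

module Euclid where

  from-⊗ : ∀ {M N} e → M ⊗ elementary e ≡ N → (InΠ N → Gen Elementary N) → InΠ M → Gen Elementary M
  from-⊗ {M} e refl generate u = subst (Gen Elementary) M⊗e⊗e⁻¹≡M
    (gen-inv (generate (InΠ-⊗ M (elementary e) u (elementary∈Π e))) (e , refl))
    where
    M⊗e⊗e⁻¹≡M : M ⊗ elementary e ⊗ inv (elementary e) ≡ M
    M⊗e⊗e⁻¹≡M = trans (⊗-assoc M _ _) (trans (cong (M ⊗_) (⊗-inverseʳ (elementary e) (elementary∈Π e))) (⊗-identityʳ M))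

  from-⊗⁻¹ : ∀ {M N} e → M ⊗ inv (elementary e) ≡ N → (InΠ N → Gen Elementary N) → InΠ M → Gen Elementary M
  from-⊗⁻¹ {M} e refl generate u = subst (Gen Elementary) M⊗e⁻¹⊗e≡M
    (gen-mul (generate (InΠ-⊗ M (inv (elementary e)) u (InΠ-inv (elementary e) (elementary∈Π e)))) (e , refl))
    where
    M⊗e⁻¹⊗e≡M : M ⊗ inv (elementary e) ⊗ elementary e ≡ M
    M⊗e⁻¹⊗e≡M = trans (⊗-assoc M _ _) (trans (cong (M ⊗_) (⊗-inverseˡ (elementary e) (elementary∈Π e))) (⊗-identityʳ M))

  ⊗-shear : ∀ a b c d → mat a b c d ⊗ shear ≡ mat a (b + a) c (d + c)
  ⊗-shear a b c d = mat-cong (first a b) (second a b) (first c d) (second c d)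
    where
    first : ∀ x y → x * + 1 + y * + 0 ≡ x
    first = solve-∀
    second : ∀ x y → x * + 1 + y * + 1 ≡ y + x
    second = solve-∀

  ⊗-shear⁻¹ : ∀ a b c d → mat a b c d ⊗ inv shear ≡ mat a (b - a) c (d - c)
  ⊗-shear⁻¹ a b c d = mat-cong (first a b) (second a b) (first c d) (second c d)
    where
    first : ∀ x y → x * + 1 + y * + 0 ≡ x
    first = solve-∀
    second : ∀ x y → x * -1ℤ + y * + 1 ≡ y - x
    second = solve-∀

  ⊗-swap : ∀ a b c d → mat a b c d ⊗ swap ≡ mat b a d c
  ⊗-swap a b c d = mat-cong (first a b) (second a b) (first c d) (second c d)
    where
    first : ∀ x y → x * + 0 + y * + 1 ≡ y
    first = solve-∀
    second : ∀ x y → x * + 1 + y * + 0 ≡ x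
    second = solve-∀

  diagonal : ∀ {a d} → IsUnit a → IsUnit d → Gen Elementary (mat a (+ 0) (+ 0) d)
  diagonal (inj₁ refl) (inj₁ refl) = gen-id
  diagonal (inj₁ refl) (inj₂ refl) = gen-resp (inj₂ refl) (gen-mul gen-id (# 2 , refl))
  diagonal (inj₂ refl) (inj₁ refl) = gen-mul gen-id (# 2 , refl)
  diagonal (inj₂ refl) (inj₂ refl) = gen-resp (inj₂ refl) gen-id

  triangular-units : ∀ {a b d} → InΠ (mat a b (+ 0) d) → IsUnit a × IsUnit d
  triangular-units {a} {b} {d} u =
    ∣x∣≡1⇒unit (ℕ.m*n≡1⇒m≡1 ∣ a ∣ ∣ d ∣ ∣a∣∣d∣≡1) , ∣x∣≡1⇒unit (ℕ.m*n≡1⇒n≡1 ∣ a ∣ ∣ d ∣ ∣a∣∣d∣≡1)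
    where
    det≡ad : ∀ a b d → a * d - b * + 0 ≡ a * d
    det≡ad = solve-∀
    ∣a∣∣d∣≡1 : ∣ a ∣ ℕ.* ∣ d ∣ ≡ 1
    ∣a∣∣d∣≡1 = trans (sym (ℤ.abs-* a d)) (trans (cong ∣_∣ (sym (det≡ad a b d))) (unit⇒∣x∣≡1 u))

  upper-triangular : ∀ n a b d → ∣ b ∣ < n → InΠ (mat a b (+ 0) d) → Gen Elementary (mat a b (+ 0) d)
  upper-triangular (suc n) a b d (s≤s ∣b∣≤n) u with triangular-units {a} {b} {d} u | b ℤ.≟ + 0
  ... | a-unit , d-unit | yes refl = diagonal a-unit d-unit
  ... | a-unit , _ | no b≢0 with shrink a b (unit⇒≢0 a-unit) ∣a∣≤∣b∣
    where
    ∣a∣≤∣b∣ : ∣ a ∣ ≤ ∣ b ∣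
    ∣a∣≤∣b∣ = subst (_≤ ∣ b ∣) (sym (unit⇒∣x∣≡1 a-unit)) (ℕ.n≢0⇒n>0 (b≢0 ∘ ℤ.∣i∣≡0⇒i≡0))
  ...   | inj₁ smaller = from-⊗ zero (⊗-shear a b (+ 0) d)
                           (upper-triangular n a (b + a) (d + + 0) (ℕ.<-≤-trans smaller ∣b∣≤n)) u
  ...   | inj₂ smaller = from-⊗⁻¹ zero (⊗-shear⁻¹ a b (+ 0) d)
                           (upper-triangular n a (b - a) (d - + 0) (ℕ.<-≤-trans smaller ∣b∣≤n)) u

  shorter : ∀ x y y′ {n} → ∣ y′ ∣ < ∣ y ∣ → ∣ x ∣ ℕ.+ ∣ y ∣ ≤ n → ∣ x ∣ ℕ.+ ∣ y′ ∣ < n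
  shorter x y y′ smaller bound = ℕ.<-≤-trans (ℕ.+-monoʳ-< ∣ x ∣ smaller) bound

  shorter-swapped : ∀ x y x′ {n} → ∣ x′ ∣ < ∣ x ∣ → ∣ x ∣ ℕ.+ ∣ y ∣ ≤ n → ∣ y ∣ ℕ.+ ∣ x′ ∣ < n
  shorter-swapped x y x′ {n} smaller bound = shorter y x x′ smaller (subst (_≤ n) (ℕ.+-comm ∣ x ∣ ∣ y ∣) bound)

  -- Column operations shrink the bottom row until it has a zero entry.
  reduce : ∀ n a b c d → ∣ c ∣ ℕ.+ ∣ d ∣ < n → InΠ (mat a b c d) → Gen Elementary (mat a b c d)
  reduce (suc n) a b c d (s≤s bound) u with c ℤ.≟ + 0 | d ℤ.≟ + 0
  ... | yes refl | _ = upper-triangular (suc ∣ b ∣) a b d ℕ.≤-refl u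
  ... | no _ | yes refl = from-⊗ (# 1) (⊗-swap a b c (+ 0)) (upper-triangular (suc ∣ a ∣) b a c ℕ.≤-refl) u
  ... | no c≢0 | no d≢0 with ∣ c ∣ ≤? ∣ d ∣
  ...   | yes ∣c∣≤∣d∣ with shrink c d c≢0 ∣c∣≤∣d∣
  ...     | inj₁ smaller = from-⊗ zero (⊗-shear a b c d)
                             (reduce n a (b + a) c (d + c) (shorter c d (d + c) smaller bound)) u
  ...     | inj₂ smaller = from-⊗⁻¹ zero (⊗-shear⁻¹ a b c d)
                             (reduce n a (b - a) c (d - c) (shorter c d (d - c) smaller bound)) u
  reduce (suc n) a b c d (s≤s bound) u | no c≢0 | no d≢0 | no ∣c∣≰∣d∣ with shrink d c d≢0 (ℕ.≰⇒≥ ∣c∣≰∣d∣)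
  ...     | inj₁ smaller = from-⊗ (# 1) (⊗-swap a b c d) (from-⊗ zero (⊗-shear b a d c)
                             (reduce n b (a + b) d (c + d) (shorter-swapped c d (c + d) smaller bound))) u
  ...     | inj₂ smaller = from-⊗ (# 1) (⊗-swap a b c d) (from-⊗⁻¹ zero (⊗-shear⁻¹ b a d c)
                             (reduce n b (a - b) d (c - d) (shorter-swapped c d (c - d) smaller bound))) u

Π⊆Gen-elementary : ∀ {M} → InΠ M → Gen Elementary M
Π⊆Gen-elementary {mat a b c d} = Euclid.reduce (suc (∣ c ∣ ℕ.+ ∣ d ∣)) a b c d ℕ.≤-refl

conj : Mat → Mat → Mat
conj g h = g ⊗ h ⊗ inv g

conj-⊗ : ∀ g → InΠ g → ∀ h h′ → conj g (h ⊗ h′) ≡ conj g h ⊗ conj g h′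
conj-⊗ g u h h′ = begin
  g ⊗ (h ⊗ h′) ⊗ inv g                 ≡⟨ cong (_⊗ inv g) (sym (⊗-assoc g h h′)) ⟩
  g ⊗ h ⊗ h′ ⊗ inv g                   ≡⟨ cong (λ X → X ⊗ h′ ⊗ inv g) (sym (⊗-identityʳ (g ⊗ h))) ⟩
  g ⊗ h ⊗ I ⊗ h′ ⊗ inv g               ≡⟨ cong (λ X → g ⊗ h ⊗ X ⊗ h′ ⊗ inv g) (sym (⊗-inverseˡ g u)) ⟩
  g ⊗ h ⊗ (inv g ⊗ g) ⊗ h′ ⊗ inv g     ≡⟨ cong (λ X → X ⊗ h′ ⊗ inv g) (sym (⊗-assoc (g ⊗ h) (inv g) g)) ⟩
  conj g h ⊗ g ⊗ h′ ⊗ inv g            ≡⟨ cong (_⊗ inv g) (⊗-assoc (conj g h) g h′) ⟩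
  conj g h ⊗ (g ⊗ h′) ⊗ inv g          ≡⟨ ⊗-assoc (conj g h) (g ⊗ h′) (inv g) ⟩
  conj g h ⊗ conj g h′                 ∎
  where open ≡-Reasoning

conj-I : ∀ g → InΠ g → conj g I ≡ I
conj-I g u = trans (cong (_⊗ inv g) (⊗-identityʳ g)) (⊗-inverseʳ g u)

conj-by-I : ∀ h → conj I h ≡ h
conj-by-I h = trans (⊗-identityʳ (I ⊗ h)) (⊗-identityˡ h)

conj-inv : ∀ g h → InΠ g → InΠ h → conj g (inv h) ≡ inv (conj g h)
conj-inv g h u v = inverse-unique (conj g h) (InΠ-⊗ (g ⊗ h) (inv g) (InΠ-⊗ g h u v) (InΠ-inv g u))
  (trans (sym (conj-⊗ g u (inv h) h)) (trans (cong (conj g) (⊗-inverseˡ h v)) (conj-I g u)))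

conj-∘ : ∀ g g′ → InΠ g → InΠ g′ → ∀ h → conj (g ⊗ g′) h ≡ conj g (conj g′ h)
conj-∘ g g′ u u′ h = begin
  g ⊗ g′ ⊗ h ⊗ inv (g ⊗ g′)            ≡⟨ cong (g ⊗ g′ ⊗ h ⊗_) (inv-⊗ g g′ u u′) ⟩
  g ⊗ g′ ⊗ h ⊗ (inv g′ ⊗ inv g)        ≡⟨ sym (⊗-assoc (g ⊗ g′ ⊗ h) (inv g′) (inv g)) ⟩
  g ⊗ g′ ⊗ h ⊗ inv g′ ⊗ inv g          ≡⟨ cong (λ X → X ⊗ inv g′ ⊗ inv g) (⊗-assoc g g′ h) ⟩
  g ⊗ (g′ ⊗ h) ⊗ inv g′ ⊗ inv g        ≡⟨ cong (_⊗ inv g) (⊗-assoc g (g′ ⊗ h) (inv g′)) ⟩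
  g ⊗ conj g′ h ⊗ inv g                ∎
  where open ≡-Reasoning

⊗-as-conj : ∀ g h → InΠ g → g ⊗ h ≡ conj g h ⊗ g
⊗-as-conj g h u = sym (begin
  g ⊗ h ⊗ inv g ⊗ g      ≡⟨ ⊗-assoc (g ⊗ h) (inv g) g ⟩
  g ⊗ h ⊗ (inv g ⊗ g)    ≡⟨ cong (g ⊗ h ⊗_) (⊗-inverseˡ g u) ⟩
  g ⊗ h ⊗ I              ≡⟨ ⊗-identityʳ (g ⊗ h) ⟩
  g ⊗ h                  ∎)
  where open ≡-Reasoning

conj-resp : ∀ {g g′} h → InΠ g → g ~ g′ → conj g h ~ conj g′ h
conj-resp {g} {g′} h u g~g′ = ~-trans (⊗-congʳ (inv g) (⊗-congʳ h g~g′)) (⊗-congˡ (g′ ⊗ h) (inv-cong u g~g′))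

conj-congʳ : ∀ g {h h′} → h ~ h′ → conj g h ~ conj g h′
conj-congʳ g h~h′ = ⊗-congʳ (inv g) (⊗-congˡ g h~h′)

module Normaliser {K : Mat → Set} (K-subgroup : IsSubgroup K) where
  open IsSubgroup K-subgroup

  Normalises : Mat → Set
  Normalises g = ∀ {h} → K h → K (conj g h)

  Normaliser : Mat → Set
  Normaliser g = InΠ g × Normalises g × Normalises (inv g)

  normaliser-isSubgroup : IsSubgroup Normaliser
  normaliser-isSubgroup = record
    { ⊆Π = proj₁
    ; resp = λ { {g} {g′} g~g′ (u , ng , ng⁻¹) →
        InΠ-resp g~g′ u ,
        (λ {h} Kh → resp (conj-resp h u g~g′) (ng Kh)) ,
        (λ {h} Kh → resp (conj-resp h (InΠ-inv g u) (inv-cong u g~g′)) (ng⁻¹ Kh)) }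
    ; has-id = inj₁ refl , (λ {h} Kh → subst K (sym (conj-by-I h)) Kh) , (λ {h} Kh → subst K (sym (conj-by-I h)) Kh)
    ; mul = λ { {g} {g′} (u , ng , ng⁻¹) (u′ , ng′ , ng′⁻¹) →
        InΠ-⊗ g g′ u u′ ,
        (λ {h} Kh → subst K (sym (conj-∘ g g′ u u′ h)) (ng (ng′ Kh))) ,
        (λ {h} Kh → subst K (sym (trans (cong (λ X → conj X h) (inv-⊗ g g′ u u′))
                                        (conj-∘ (inv g′) (inv g) (InΠ-inv g′ u′) (InΠ-inv g u) h)))
                            (ng′⁻¹ (ng⁻¹ Kh))) }
    ; has-inv = λ { {g} (u , ng , ng⁻¹) → InΠ-inv g u , ng⁻¹ , subst Normalises (sym (inv-involutive g u)) ng }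
    }

  normal-if-elementary-normalise : (∀ e → Normalises (elementary e) × Normalises (inv (elementary e))) → IsNormal K
  normal-if-elementary-normalise elementary-normalises {g} u =
    proj₁ (proj₂ (Gen-least normaliser-isSubgroup elementary-normaliser (Π⊆Gen-elementary {g} u)))
    where
    elementary-normaliser : ∀ {s} → Elementary s → Normaliser s
    elementary-normaliser (e , refl) = elementary∈Π e , elementary-normalises e

module _ {S : Mat → Set} (S⊆Π : ∀ {s} → S s → InΠ s) where
  open Normaliser (Gen-isSubgroup (λ {s} → S⊆Π {s}))

  Gen-normalised : ∀ {g} → InΠ g → (∀ {s} → S s → Gen S (conj g s)) → Normalises g
  Gen-normalised {g} u conj-generator = normalised
    where
    normalised : ∀ {h} → Gen S h → Gen S (conj g h)
    normalised gen-id = subst (Gen S) (sym (conj-I g u)) gen-id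
    normalised (gen-mul {h} {s} Sh s∈S) =
      subst (Gen S) (sym (conj-⊗ g u h s)) (Gen-⊗ (normalised Sh) (conj-generator s∈S))
    normalised (gen-inv {h} {s} Sh s∈S) =
      subst (Gen S) (sym (trans (conj-⊗ g u h (inv s)) (cong (conj g h ⊗_) (conj-inv g s u (S⊆Π s∈S)))))
            (Gen-⊗ (normalised Sh) (Gen-inv S⊆Π (conj-generator s∈S)))
    normalised (gen-resp h~h′ Sh) = gen-resp (conj-congʳ g h~h′) (normalised Sh)

-- The action of Π on superbases

act : Mat → V2 → V2
act (mat a b c d) (v2 x y) = v2 (a * x + b * y) (c * x + d * y)

actT : Mat → Triple → Triple
actT M (tri u v w) = tri (act M u) (act M v) (act M w)

v2-cong : ∀ {x y x′ y′} → x ≡ x′ → y ≡ y′ → v2 x y ≡ v2 x′ y′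
v2-cong refl refl = refl

tri-cong : ∀ {u v w u′ v′ w′} → u ≡ u′ → v ≡ v′ → w ≡ w′ → tri u v w ≡ tri u′ v′ w′
tri-cong refl refl refl = refl

act-⊗ : ∀ A B v → act (A ⊗ B) v ≡ act A (act B v)
act-⊗ (mat a b c d) (mat e f g h) (v2 x y) = v2-cong (entry a b e f g h x y) (entry c d e f g h x y)
  where
  entry : ∀ p q e f g h x y → (p * e + q * g) * x + (p * f + q * h) * y ≡ p * (e * x + f * y) + q * (g * x + h * y)
  entry = solve-∀

act-I : ∀ v → act I v ≡ v
act-I (v2 x y) = v2-cong (entry x y) (entry′ x y)
  where
  entry : ∀ x y → + 1 * x + + 0 * y ≡ x
  entry = solve-∀
  entry′ : ∀ x y → + 0 * x + + 1 * y ≡ y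
  entry′ = solve-∀

act-negV : ∀ A v → act A (negV v) ≡ negV (act A v)
act-negV (mat a b c d) (v2 x y) = v2-cong (entry a b x y) (entry c d x y)
  where
  entry : ∀ p q x y → p * (- x) + q * (- y) ≡ - (p * x + q * y)
  entry = solve-∀

negV-involutive : ∀ v → negV (negV v) ≡ v
negV-involutive (v2 x y) = v2-cong (ℤ.neg-involutive x) (ℤ.neg-involutive y)

actT-⊗ : ∀ A B T → actT (A ⊗ B) T ≡ actT A (actT B T)
actT-⊗ A B (tri u v w) = tri-cong (act-⊗ A B u) (act-⊗ A B v) (act-⊗ A B w)

actT-inverseˡ : ∀ M → InΠ M → ∀ T → actT (inv M) (actT M T) ≡ T
actT-inverseˡ M u T = begin
  actT (inv M) (actT M T)  ≡⟨ sym (actT-⊗ (inv M) M T) ⟩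
  actT (inv M ⊗ M) T       ≡⟨ cong (λ X → actT X T) (⊗-inverseˡ M u) ⟩
  actT I T                 ≡⟨ actT-I T ⟩
  T                        ∎
  where
  open ≡-Reasoning
  actT-I : ∀ T → actT I T ≡ T
  actT-I (tri u v w) = tri-cong (act-I u) (act-I v) (act-I w)

φ-⊗ : ∀ A B → φ (A ⊗ B) ≡ actT A (φ B)
φ-⊗ (mat a b c d) (mat e f g h) = tri-cong refl refl (v2-cong (sum a b e f g h) (sum c d e f g h))
  where
  sum : ∀ p q e f g h → (p * e + q * g) + (p * f + q * h) ≡ p * (e + f) + q * (g + h)
  sum = solve-∀

T₀ : Triple
T₀ = φ I

φ-as-act : ∀ M → φ M ≡ actT M T₀
φ-as-act M = trans (cong φ (sym (⊗-identityʳ M))) (φ-⊗ M I)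

≈P-refl : ∀ {p} → p ≈P p
≈P-refl = inj₁ refl

≈P-sym : ∀ {p q} → p ≈P q → q ≈P p
≈P-sym (inj₁ refl) = inj₁ refl
≈P-sym {q = q} (inj₂ refl) = inj₂ (sym (negV-involutive q))

≈P-trans : ∀ {p q r} → p ≈P q → q ≈P r → p ≈P r
≈P-trans (inj₁ refl) q≈r = q≈r
≈P-trans (inj₂ refl) (inj₁ refl) = inj₂ refl
≈P-trans (inj₂ refl) (inj₂ refl) = inj₁ (negV-involutive _)

≈P-act : ∀ M {p q} → p ≈P q → act M p ≈P act M q
≈P-act M (inj₁ refl) = inj₁ refl
≈P-act M {q = q} (inj₂ refl) = inj₂ (act-negV M q)

≈P-unact : ∀ M {p q} → InΠ M → act M p ≈P act M q → p ≈P q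
≈P-unact M {p} {q} u Mp≈Mq = subst₂ _≈P_ (act-inverseˡ p) (act-inverseˡ q) (≈P-act (inv M) Mp≈Mq)
  where
  act-inverseˡ : ∀ v → act (inv M) (act M v) ≡ v
  act-inverseˡ v = cong p₁ (actT-inverseˡ M u (tri v v v))

∈T-resp : ∀ {p q T} → p ≈P q → p ∈T T → q ∈T T
∈T-resp p≈q (inj₁ p≈u) = inj₁ (≈P-trans (≈P-sym p≈q) p≈u)
∈T-resp p≈q (inj₂ (inj₁ p≈v)) = inj₂ (inj₁ (≈P-trans (≈P-sym p≈q) p≈v))
∈T-resp p≈q (inj₂ (inj₂ p≈w)) = inj₂ (inj₂ (≈P-trans (≈P-sym p≈q) p≈w))

∈T-act : ∀ M {p T} → p ∈T T → act M p ∈T actT M T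
∈T-act M (inj₁ p≈u) = inj₁ (≈P-act M p≈u)
∈T-act M (inj₂ (inj₁ p≈v)) = inj₂ (inj₁ (≈P-act M p≈v))
∈T-act M (inj₂ (inj₂ p≈w)) = inj₂ (inj₂ (≈P-act M p≈w))

_⊆T_ : Triple → Triple → Set
T ⊆T T′ = (p₁ T ∈T T′) × (p₂ T ∈T T′) × (p₃ T ∈T T′)

⊆T-∈T : ∀ {T T′ p} → T ⊆T T′ → p ∈T T → p ∈T T′
⊆T-∈T (u∈ , v∈ , w∈) (inj₁ p≈u) = ∈T-resp (≈P-sym p≈u) u∈
⊆T-∈T (u∈ , v∈ , w∈) (inj₂ (inj₁ p≈v)) = ∈T-resp (≈P-sym p≈v) v∈
⊆T-∈T (u∈ , v∈ , w∈) (inj₂ (inj₂ p≈w)) = ∈T-resp (≈P-sym p≈w) w∈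

≈T-intro : ∀ {T T′} → T ⊆T T′ → T′ ⊆T T → T ≈T T′
≈T-intro T⊆T′ T′⊆T p = ⊆T-∈T T⊆T′ , ⊆T-∈T T′⊆T

≈T-⊆T : ∀ {T T′} → T ≈T T′ → T ⊆T T′
≈T-⊆T {tri u v w} T≈T′ =
  proj₁ (T≈T′ u) (inj₁ ≈P-refl) , proj₁ (T≈T′ v) (inj₂ (inj₁ ≈P-refl)) , proj₁ (T≈T′ w) (inj₂ (inj₂ ≈P-refl))

≈T-refl : ∀ {T} → T ≈T T
≈T-refl p = (λ p∈ → p∈) , (λ p∈ → p∈)

≈T-sym : ∀ {T T′} → T ≈T T′ → T′ ≈T T
≈T-sym T≈T′ p = proj₂ (T≈T′ p) , proj₁ (T≈T′ p)

≈T-trans : ∀ {T T′ T″} → T ≈T T′ → T′ ≈T T″ → T ≈T T″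
≈T-trans T≈T′ T′≈T″ p = (λ p∈ → proj₁ (T′≈T″ p) (proj₁ (T≈T′ p) p∈)) , (λ p∈ → proj₂ (T≈T′ p) (proj₂ (T′≈T″ p) p∈))

≈T-setoid : Setoid 0ℓ 0ℓ
≈T-setoid = record
  { Carrier = Triple ; _≈_ = _≈T_
  ; isEquivalence = record { refl = ≈T-refl ; sym = ≈T-sym ; trans = ≈T-trans } }

module ≈T-Reasoning = SetoidReasoning ≈T-setoid

⊆T-act : ∀ M {T T′} → T ⊆T T′ → actT M T ⊆T actT M T′
⊆T-act M {tri u v w} (u∈ , v∈ , w∈) = ∈T-act M u∈ , ∈T-act M v∈ , ∈T-act M w∈

≈T-act : ∀ M {T T′} → T ≈T T′ → actT M T ≈T actT M T′
≈T-act M T≈T′ = ≈T-intro (⊆T-act M (≈T-⊆T T≈T′)) (⊆T-act M (≈T-⊆T (≈T-sym T≈T′)))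

≈T-unact : ∀ M {T T′} → InΠ M → actT M T ≈T actT M T′ → T ≈T T′
≈T-unact M {T} {T′} u MT≈MT′ = subst₂ _≈T_ (actT-inverseˡ M u T) (actT-inverseˡ M u T′) (≈T-act (inv M) MT≈MT′)

≈T-pointwise : ∀ {u v w u′ v′ w′} → u ≈P u′ → v ≈P v′ → w ≈P w′ → tri u v w ≈T tri u′ v′ w′
≈T-pointwise u≈u′ v≈v′ w≈w′ = ≈T-intro
  (inj₁ u≈u′ , inj₂ (inj₁ v≈v′) , inj₂ (inj₂ w≈w′))
  (inj₁ (≈P-sym u≈u′) , inj₂ (inj₁ (≈P-sym v≈v′)) , inj₂ (inj₂ (≈P-sym w≈w′)))

φ-resp : ∀ {A B} → A ~ B → φ A ≈T φ B
φ-resp (inj₁ refl) = ≈T-refl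
φ-resp {B = mat a b c d} (inj₂ refl) =
  subst (_≈T φ (mat a b c d)) (tri-cong refl refl (v2-cong (ℤ.neg-distrib-+ a b) (ℤ.neg-distrib-+ c d)))
    (≈T-pointwise (inj₂ refl) (inj₂ refl) (inj₂ refl))

Adj-sym : ∀ {T T′} → Adj T T′ → Adj T′ T
Adj-sym (T≉T′ , p , q , p≉q , p∈T , p∈T′ , q∈T , q∈T′) =
  (λ T′≈T → T≉T′ (≈T-sym T′≈T)) , p , q , p≉q , p∈T′ , p∈T , q∈T′ , q∈T

Adj-resp : ∀ {T₁ T₂ T₁′ T₂′} → T₁ ≈T T₂ → T₁′ ≈T T₂′ → Adj T₁ T₁′ → Adj T₂ T₂′
Adj-resp T₁≈T₂ T₁′≈T₂′ (T≉T′ , p , q , p≉q , p∈T , p∈T′ , q∈T , q∈T′) =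
  (λ T₂≈T₂′ → T≉T′ (≈T-trans T₁≈T₂ (≈T-trans T₂≈T₂′ (≈T-sym T₁′≈T₂′)))) , p , q , p≉q ,
  proj₁ (T₁≈T₂ p) p∈T , proj₁ (T₁′≈T₂′ p) p∈T′ , proj₁ (T₁≈T₂ q) q∈T , proj₁ (T₁′≈T₂′ q) q∈T′

Adj-act : ∀ M {T T′} → InΠ M → Adj T T′ → Adj (actT M T) (actT M T′)
Adj-act M u (T≉T′ , p , q , p≉q , p∈T , p∈T′ , q∈T , q∈T′) =
  (λ MT≈MT′ → T≉T′ (≈T-unact M u MT≈MT′)) , act M p , act M q , (λ Mp≈Mq → p≉q (≈P-unact M u Mp≈Mq)) ,
  ∈T-act M p∈T , ∈T-act M p∈T′ , ∈T-act M q∈T , ∈T-act M q∈T′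

φ-translate : ∀ h {k k′} → φ k ≈T φ k′ → φ (h ⊗ k) ≈T φ (h ⊗ k′)
φ-translate h {k} {k′} k≈k′ = subst₂ _≈T_ (sym (φ-⊗ h k)) (sym (φ-⊗ h k′)) (≈T-act h k≈k′)

≈T-relative : ∀ h {h′} → InΠ h → φ h ≈T φ h′ → T₀ ≈T φ (inv h ⊗ h′)
≈T-relative h {h′} u h≈h′ = subst (_≈T φ (inv h ⊗ h′)) (cong φ (⊗-inverseˡ h u)) (φ-translate (inv h) h≈h′)

Adj-relative : ∀ h {h′} → InΠ h → Adj (φ h) (φ h′) → Adj T₀ (φ (inv h ⊗ h′))
Adj-relative h {h′} u adj = subst₂ Adj
  (trans (sym (φ-⊗ (inv h) h)) (cong φ (⊗-inverseˡ h u))) (sym (φ-⊗ (inv h) h′)) (Adj-act (inv h) (InΠ-inv h u) adj)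

Adj-translate : ∀ h {k} → InΠ h → Adj T₀ (φ k) → Adj (φ h) (φ (h ⊗ k))
Adj-translate h {k} u adj = subst₂ Adj (sym (φ-as-act h)) (sym (φ-⊗ h k)) (Adj-act h u adj)

_≟V_ : (u v : V2) → Dec (u ≡ v)
v2 x y ≟V v2 x′ y′ = map′ (uncurry v2-cong) (λ e → cong V2.x e , cong V2.y e) ((x ℤ.≟ x′) ×-dec (y ℤ.≟ y′))

_≈P?_ : (p q : V2) → Dec (p ≈P q)
p ≈P? q = (p ≟V q) ⊎-dec (p ≟V negV q)

_∈T?_ : (p : V2) (T : Triple) → Dec (p ∈T T)
p ∈T? tri u v w = (p ≈P? u) ⊎-dec (p ≈P? v) ⊎-dec (p ≈P? w)

_⊆T?_ : (T T′ : Triple) → Dec (T ⊆T T′)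
tri u v w ⊆T? T′ = (u ∈T? T′) ×-dec (v ∈T? T′) ×-dec (w ∈T? T′)

_≈T?_ : (T T′ : Triple) → Dec (T ≈T T′)
T ≈T? T′ = map′ (uncurry ≈T-intro) (λ T≈T′ → ≈T-⊆T T≈T′ , ≈T-⊆T (≈T-sym T≈T′)) ((T ⊆T? T′) ×-dec (T′ ⊆T? T))

-- The base superbasis T₀, its stabiliser and its neighbours

σ : Fin 6 → Mat
σ = lookup ( I ∷ swap ∷ mat (+ 1) -1ℤ (+ 0) -1ℤ ∷ mat (+ 1) -1ℤ (+ 1) (+ 0)
           ∷ mat (+ 1) (+ 0) (+ 1) -1ℤ ∷ mat (+ 0) -1ℤ (+ 1) -1ℤ ∷ [])

γ : Fin 3 → Mat
γ = lookup (γ₁ ∷ γ₂ ∷ γ₃ ∷ [])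

σ∈Π : ∀ s → InΠ (σ s)
σ∈Π = from-yes (all? λ s → InΠ? (σ s))

point : Fin 3 → Triple → V2
point zero = p₁
point (suc zero) = p₂
point (suc (suc zero)) = p₃

∈T-point : ∀ {p T} → p ∈T T → ∃ λ a → p ≈P point a T
∈T-point (inj₁ p≈u) = zero , p≈u
∈T-point (inj₂ (inj₁ p≈v)) = suc zero , p≈v
∈T-point (inj₂ (inj₂ p≈w)) = suc (suc zero) , p≈w

point-∈T : ∀ a T → point a T ∈T T
point-∈T zero (tri u v w) = inj₁ ≈P-refl
point-∈T (suc zero) (tri u v w) = inj₂ (inj₁ ≈P-refl)
point-∈T (suc (suc zero)) (tri u v w) = inj₂ (inj₂ ≈P-refl)

SharedPair : Triple → Triple → Set
SharedPair T T′ = ∃ λ a → ∃ λ a′ → ¬ (point a T ≈P point a′ T) × (point a T ∈T T′) × (point a′ T ∈T T′)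

sharedPair? : ∀ T T′ → Dec (SharedPair T T′)
sharedPair? T T′ = any? λ a → any? λ a′ → ¬? (point a T ≈P? point a′ T) ×-dec (point a T ∈T? T′) ×-dec (point a′ T ∈T? T′)

adjacent : ∀ {T T′} → ¬ (T ≈T T′) → SharedPair T T′ → Adj T T′
adjacent {T} T≉T′ (a , a′ , a≉a′ , a∈T′ , a′∈T′) =
  T≉T′ , point a T , point a′ T , a≉a′ , point-∈T a T , a∈T′ , point-∈T a′ T , a′∈T′

γ-adjacent : ∀ n → Adj T₀ (φ (γ n))
γ-adjacent n = adjacent (from-yes (all? λ n → ¬? (T₀ ≈T? φ (γ n))) n) (from-yes (all? λ n → sharedPair? T₀ (φ (γ n))) n)

±T₀ : Fin 6 → V2
±T₀ = lookup ( v2 (+ 1) (+ 0) ∷ v2 -1ℤ (+ 0) ∷ v2 (+ 0) (+ 1) ∷ v2 (+ 0) -1ℤ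
             ∷ v2 (+ 1) (+ 1) ∷ v2 -1ℤ -1ℤ ∷ [])

∈T₀ : ∀ {p} → p ∈T T₀ → ∃ λ i → p ≡ ±T₀ i
∈T₀ (inj₁ (inj₁ refl)) = zero , refl
∈T₀ (inj₁ (inj₂ refl)) = suc zero , refl
∈T₀ (inj₂ (inj₁ (inj₁ refl))) = suc (suc zero) , refl
∈T₀ (inj₂ (inj₁ (inj₂ refl))) = suc (suc (suc zero)) , refl
∈T₀ (inj₂ (inj₂ (inj₁ refl))) = suc (suc (suc (suc zero))) , refl
∈T₀ (inj₂ (inj₂ (inj₂ refl))) = suc (suc (suc (suc (suc zero)))) , refl

_-ᵥ_ : V2 → V2 → V2
v2 x y -ᵥ v2 x′ y′ = v2 (x - x′) (y - y′)

fromColumns : V2 → V2 → Mat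
fromColumns (v2 a c) (v2 b d) = mat a b c d

-- The matrix k with point a (φ k) ≡ x and point a′ (φ k) ≡ y; junk (I) when a ≡ a′.
fromPoints : Fin 3 → Fin 3 → V2 → V2 → Mat
fromPoints zero (suc zero) u v = fromColumns u v
fromPoints (suc zero) zero v u = fromColumns u v
fromPoints zero (suc (suc zero)) u w = fromColumns u (w -ᵥ u)
fromPoints (suc (suc zero)) zero w u = fromColumns u (w -ᵥ u)
fromPoints (suc zero) (suc (suc zero)) v w = fromColumns (w -ᵥ v) v
fromPoints (suc (suc zero)) (suc zero) w v = fromColumns (w -ᵥ v) v
fromPoints _ _ _ _ = I

[x+y]-x≡y : ∀ x y → (x + y) - x ≡ y
[x+y]-x≡y = solve-∀

[x+y]-y≡x : ∀ x y → (x + y) - y ≡ x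
[x+y]-y≡x = solve-∀

fromPoints-φ : ∀ a a′ k → a ≢ a′ → fromPoints a a′ (point a (φ k)) (point a′ (φ k)) ≡ k
fromPoints-φ zero zero k a≢a′ = ⊥-elim (a≢a′ refl)
fromPoints-φ zero (suc zero) (mat a b c d) _ = refl
fromPoints-φ zero (suc (suc zero)) (mat a b c d) _ = mat-cong refl ([x+y]-x≡y a b) refl ([x+y]-x≡y c d)
fromPoints-φ (suc zero) zero (mat a b c d) _ = refl
fromPoints-φ (suc zero) (suc zero) k a≢a′ = ⊥-elim (a≢a′ refl)
fromPoints-φ (suc zero) (suc (suc zero)) (mat a b c d) _ = mat-cong ([x+y]-y≡x a b) refl ([x+y]-y≡x c d) refl
fromPoints-φ (suc (suc zero)) zero (mat a b c d) _ = mat-cong refl ([x+y]-x≡y a b) refl ([x+y]-x≡y c d)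
fromPoints-φ (suc (suc zero)) (suc zero) (mat a b c d) _ = mat-cong ([x+y]-y≡x a b) refl ([x+y]-y≡x c d) refl
fromPoints-φ (suc (suc zero)) (suc (suc zero)) k a≢a′ = ⊥-elim (a≢a′ refl)

TwoShared : Triple → Triple → Set
TwoShared T T′ = Σ V2 λ p → Σ V2 λ q → ¬ (p ≈P q) × (p ∈T T) × (p ∈T T′) × (q ∈T T) × (q ∈T T′)

candidate : Fin 3 → Fin 3 → Fin 6 → Fin 6 → Mat
candidate a a′ i j = fromPoints a a′ (±T₀ i) (±T₀ j)

Candidate : Mat → Set
Candidate k = ∃ λ a → ∃ λ a′ → ∃ λ i → ∃ λ j → a ≢ a′ × k ≡ candidate a a′ i j

sharing-two-with-T₀ : ∀ {k} → TwoShared T₀ (φ k) → Candidate k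
sharing-two-with-T₀ {k} (p , q , p≉q , p∈T₀ , p∈k , q∈T₀ , q∈k)
  with ∈T-point p∈k | ∈T-point q∈k
... | a , p≈a | a′ , q≈a′
  with ∈T₀ (∈T-resp p≈a p∈T₀) | ∈T₀ (∈T-resp q≈a′ q∈T₀)
... | i , a≡i | j , a′≡j =
  a , a′ , i , j , a≢a′ , sym (trans (cong₂ (fromPoints a a′) (sym a≡i) (sym a′≡j)) (fromPoints-φ a a′ k a≢a′))
  where
  a≢a′ : a ≢ a′
  a≢a′ refl = p≉q (≈P-trans p≈a (≈P-sym q≈a′))

module _ {Claim : Mat → Set} where

  candidates? : (∀ k → Dec (Claim k)) → Dec (∀ a a′ i j → a ≢ a′ → Claim (candidate a a′ i j))
  candidates? Claim? = all? λ a → all? λ a′ → all? λ i → all? λ j → ¬? (a ≟F a′) →-dec Claim? (candidate a a′ i j)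

  candidate-elim : ∀ {k} → Candidate k → (∀ a a′ i j → a ≢ a′ → Claim (candidate a a′ i j)) → Claim k
  candidate-elim (a , a′ , i , j , a≢a′ , refl) claimed = claimed a a′ i j a≢a′

e₁≉e₂ : ¬ (v2 (+ 1) (+ 0) ≈P v2 (+ 0) (+ 1))
e₁≉e₂ (inj₁ ())
e₁≉e₂ (inj₂ ())

-- Opaque, so that type checking never unfolds the finite searches behind them.
opaque
  stabiliser-enum : ∀ {k} → T₀ ≈T φ k → ∃ λ s → k ~ σ s
  stabiliser-enum {k} T₀≈k = candidate-elim {Claim} shared (from-yes (candidates? Claim?)) T₀≈k
    where
    Claim : Mat → Set
    Claim c = T₀ ≈T φ c → ∃ λ s → c ~ σ s
    Claim? : ∀ c → Dec (Claim c)
    Claim? c = (T₀ ≈T? φ c) →-dec any? λ s → c ~? σ s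
    shared : Candidate k
    shared = sharing-two-with-T₀ (_ , _ , e₁≉e₂ , inj₁ ≈P-refl , proj₁ (T₀≈k _) (inj₁ ≈P-refl) ,
                                  inj₂ (inj₁ ≈P-refl) , proj₁ (T₀≈k _) (inj₂ (inj₁ ≈P-refl)))

opaque
  neighbour-enum : ∀ {k} → InΠ k → Adj T₀ (φ k) → ∃ λ n → φ k ≈T φ (γ n)
  neighbour-enum {k} u (T₀≉k , shared) =
    candidate-elim {Claim} (sharing-two-with-T₀ shared) (from-yes (candidates? Claim?)) u T₀≉k
    where
    Claim : Mat → Set
    Claim c = InΠ c → ¬ (T₀ ≈T φ c) → ∃ λ n → φ c ≈T φ (γ n)
    Claim? : ∀ c → Dec (Claim c)
    Claim? c = InΠ? c →-dec ¬? (T₀ ≈T? φ c) →-dec any? λ n → φ c ≈T? φ (γ n)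

_·ᵥ_ : ℤ → V2 → V2
s ·ᵥ v2 x y = v2 (s * x) (s * y)

unit-·ᵥ : ∀ {s} → IsUnit s → ∀ v → (s ·ᵥ v) ≈P v
unit-·ᵥ (inj₁ refl) (v2 x y) = inj₁ (v2-cong (ℤ.*-identityˡ x) (ℤ.*-identityˡ y))
unit-·ᵥ (inj₂ refl) (v2 x y) = inj₂ (v2-cong (ℤ.-1*i≡-i x) (ℤ.-1*i≡-i y))

rescale : ∀ {α} β δ x y z → α * α ≡ + 1 → δ * z ≡ α * x + β * y → x + (α * β) * y ≡ (α * δ) * z
rescale {α} β δ x y z α²≡1 δz≡ = begin
  x + (α * β) * y              ≡⟨ cong (_+ (α * β) * y) (sym (trans (cong (_* x) α²≡1) (ℤ.*-identityˡ x))) ⟩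
  (α * α) * x + (α * β) * y    ≡⟨ distribute α β x y ⟩
  α * (α * x + β * y)          ≡⟨ cong (α *_) (sym δz≡) ⟩
  α * (δ * z)                  ≡⟨ sym (ℤ.*-assoc α δ z) ⟩
  (α * δ) * z                  ∎
  where
  open ≡-Reasoning
  distribute : ∀ α β x y → (α * α) * x + (α * β) * y ≡ α * (α * x + β * y)
  distribute = solve-∀

IsSuperbasis? : ∀ T → Dec (IsSuperbasis T)
IsSuperbasis? (tri u v w) = basis? u v ×-dec basis? v w ×-dec basis? u w
  where
  basis? : ∀ u v → Dec (IsBasis u v)
  basis? u v = (det2 u v ℤ.≟ + 1) ⊎-dec (det2 u v ℤ.≟ -1ℤ)

-- Cramer: δ w = α u + β v with α, β, δ units, so u + αβ v = αδ w.
superbasis-realised : ∀ T → IsSuperbasis T → ∃ λ M → InΠ M × φ M ≈T T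
superbasis-realised (tri u@(v2 ux uy) v@(v2 vx vy) w@(v2 wx wy)) (uv-basis , vw-basis , uw-basis) =
  fromColumns u (ε ·ᵥ v) , M∈Π , ≈T-pointwise ≈P-refl (unit-·ᵥ ε-unit v) u+εv≈w
  where
  α = det2 w v
  β = det2 u w
  δ = det2 u v
  ε = α * β
  α-unit : IsUnit α
  α-unit = subst IsUnit (antisymmetric vx vy wx wy) (unit-neg vw-basis)
    where
    antisymmetric : ∀ vx vy wx wy → - (vx * wy - wx * vy) ≡ wx * vy - vx * wy
    antisymmetric = solve-∀
  ε-unit : IsUnit ε
  ε-unit = unit-* {α} {β} α-unit uw-basis
  M∈Π : InΠ (fromColumns u (ε ·ᵥ v))
  M∈Π = subst IsUnit (sym (scaled ε ux uy vx vy)) (unit-* {ε} {δ} ε-unit uv-basis)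
    where
    scaled : ∀ ε ux uy vx vy → ux * (ε * vy) - (ε * vx) * uy ≡ ε * (ux * vy - vx * uy)
    scaled = solve-∀
  cramer-x : ∀ ux uy vx vy wx wy → (ux * vy - vx * uy) * wx ≡ (wx * vy - vx * wy) * ux + (ux * wy - wx * uy) * vx
  cramer-x = solve-∀
  cramer-y : ∀ ux uy vx vy wx wy → (ux * vy - vx * uy) * wy ≡ (wx * vy - vx * wy) * uy + (ux * wy - wx * uy) * vy
  cramer-y = solve-∀
  u+εv≈w : (u ⊕ (ε ·ᵥ v)) ≈P w
  u+εv≈w = subst (_≈P w) (sym (v2-cong (rescale {α} β δ ux vx wx (unit-square α-unit) (cramer-x ux uy vx vy wx wy))
                                       (rescale {α} β δ uy vy wy (unit-square α-unit) (cramer-y ux uy vx vy wx wy))))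
                 (unit-·ᵥ (unit-* {α} {δ} α-unit uv-basis) w)

module Orbit {K : Mat → Set} (K-subgroup : IsSubgroup K) (K-normal : IsNormal K) where
  open IsSubgroup K-subgroup

  -- M ∈ K Σ, phrased through φ; because K is normal this is a subgroup.
  Reachable : Mat → Set
  Reachable M = InΠ M × ∃ λ h → K h × φ h ≈T φ M

  reachable-isSubgroup : IsSubgroup Reachable
  reachable-isSubgroup = record
    { ⊆Π = proj₁
    ; resp = λ { M~N (u , h , Kh , h≈M) → InΠ-resp M~N u , h , Kh , ≈T-trans h≈M (φ-resp M~N) }
    ; has-id = inj₁ refl , I , has-id , ≈T-refl
    ; mul = λ { {M} {N} (u , h , Kh , h≈M) (v , h′ , Kh′ , h′≈N) →
        InΠ-⊗ M N u v , conj M h′ ⊗ h , mul (K-normal {M} u Kh′) Kh , product-reached u h≈M h′≈N }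
    ; has-inv = λ { {M} (u , h , Kh , h≈M) →
        InΠ-inv M u , conj (inv M) (inv h) , K-normal {inv M} (InΠ-inv M u) (has-inv Kh) , inverse-reached u (⊆Π Kh) h≈M }
    }
    where
    open ≈T-Reasoning
    product-reached : ∀ {M N h h′} → InΠ M → φ h ≈T φ M → φ h′ ≈T φ N → φ (conj M h′ ⊗ h) ≈T φ (M ⊗ N)
    product-reached {M} {N} {h} {h′} u h≈M h′≈N = begin
      φ (conj M h′ ⊗ h)   ≈⟨ φ-translate (conj M h′) h≈M ⟩
      φ (conj M h′ ⊗ M)   ≡⟨ cong φ (sym (⊗-as-conj M h′ u)) ⟩
      φ (M ⊗ h′)          ≈⟨ φ-translate M h′≈N ⟩
      φ (M ⊗ N)           ∎
    inverse-reached : ∀ {M h} → InΠ M → InΠ h → φ h ≈T φ M → φ (conj (inv M) (inv h)) ≈T φ (inv M)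
    inverse-reached {M} {h} u v h≈M = begin
      φ (inv M ⊗ inv h ⊗ inv (inv M))  ≡⟨ cong (λ X → φ (inv M ⊗ inv h ⊗ X)) (inv-involutive M u) ⟩
      φ (inv M ⊗ inv h ⊗ M)            ≈⟨ φ-translate (inv M ⊗ inv h) (≈T-sym h≈M) ⟩
      φ (inv M ⊗ inv h ⊗ h)            ≡⟨ cong φ (⊗-assoc (inv M) (inv h) h) ⟩
      φ (inv M ⊗ (inv h ⊗ h))          ≡⟨ cong (λ X → φ (inv M ⊗ X)) (⊗-inverseˡ h v) ⟩
      φ (inv M ⊗ I)                    ≡⟨ cong φ (⊗-identityʳ (inv M)) ⟩
      φ (inv M)                        ∎

  transitive : (∀ e → ∃ λ h → K h × φ h ≈T φ (elementary e)) → ∀ {M} → InΠ M → ∃ λ h → K h × φ h ≈T φ M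
  transitive elementary-reached {M} u = proj₂ (Gen-least reachable-isSubgroup reached (Π⊆Gen-elementary {M} u))
    where
    reached : ∀ {s} → Elementary s → Reachable s
    reached (e , refl) = elementary∈Π e , elementary-reached e

-- Congruence invariants

module Congruence (m : ℤ) where

  record _≡ₘ_ (A B : Mat) : Set where
    constructor entrywise
    field
      a≡ : m ∣ Mat.a A - Mat.a B
      b≡ : m ∣ Mat.b A - Mat.b B
      c≡ : m ∣ Mat.c A - Mat.c B
      d≡ : m ∣ Mat.d A - Mat.d B

  _≡ₘ?_ : ∀ A B → Dec (A ≡ₘ B)
  A ≡ₘ? B = map′ (λ (ea , eb , ec , ed) → entrywise ea eb ec ed) (λ (entrywise ea eb ec ed) → ea , eb , ec , ed)
    ((m ∣? Mat.a A - Mat.a B) ×-dec (m ∣? Mat.b A - Mat.b B) ×-dec (m ∣? Mat.c A - Mat.c B) ×-dec (m ∣? Mat.d A - Mat.d B))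

  private
    ∣-trans-sub : ∀ x y z → m ∣ x - y → m ∣ y - z → m ∣ x - z
    ∣-trans-sub x y z m∣x-y m∣y-z = subst (m ∣_) (telescope x y z) (∣m∣n⇒∣m+n m∣x-y m∣y-z)
      where
      telescope : ∀ x y z → (x - y) + (y - z) ≡ x - z
      telescope = solve-∀

    ∣-neg-sub : ∀ x y → m ∣ x - y → m ∣ (- x) - (- y)
    ∣-neg-sub x y m∣x-y = subst (m ∣_) (negated x y) (∣m⇒∣-m m∣x-y)
      where
      negated : ∀ x y → - (x - y) ≡ (- x) - (- y)
      negated = solve-∀

    ∣-combination-sub : ∀ x y x′ y′ p q → m ∣ x - x′ → m ∣ y - y′ → m ∣ (x * p + y * q) - (x′ * p + y′ * q)
    ∣-combination-sub x y x′ y′ p q m∣x m∣y =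
      subst (m ∣_) (collect x y x′ y′ p q) (∣m∣n⇒∣m+n (∣m⇒∣m*n p m∣x) (∣m⇒∣m*n q m∣y))
      where
      collect : ∀ x y x′ y′ p q → (x - x′) * p + (y - y′) * q ≡ (x * p + y * q) - (x′ * p + y′ * q)
      collect = solve-∀

  ≡ₘ-trans : ∀ {A B C} → A ≡ₘ B → B ≡ₘ C → A ≡ₘ C
  ≡ₘ-trans {mat a b c d} {mat a′ b′ c′ d′} {mat a″ b″ c″ d″} (entrywise ea eb ec ed) (entrywise ea′ eb′ ec′ ed′) =
    entrywise (∣-trans-sub a a′ a″ ea ea′) (∣-trans-sub b b′ b″ eb eb′)
              (∣-trans-sub c c′ c″ ec ec′) (∣-trans-sub d d′ d″ ed ed′)

  ≡ₘ-negM : ∀ {A B} → A ≡ₘ B → negM A ≡ₘ negM B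
  ≡ₘ-negM {mat a b c d} {mat a′ b′ c′ d′} (entrywise ea eb ec ed) =
    entrywise (∣-neg-sub a a′ ea) (∣-neg-sub b b′ eb) (∣-neg-sub c c′ ec) (∣-neg-sub d d′ ed)

  ≡ₘ-⊗ʳ : ∀ {A A′} B → A ≡ₘ A′ → (A ⊗ B) ≡ₘ (A′ ⊗ B)
  ≡ₘ-⊗ʳ {mat a b c d} {mat a′ b′ c′ d′} (mat e f g h) (entrywise ea eb ec ed) = entrywise
    (∣-combination-sub a b a′ b′ e g ea eb) (∣-combination-sub a b a′ b′ f h ea eb)
    (∣-combination-sub c d c′ d′ e g ec ed) (∣-combination-sub c d c′ d′ f h ec ed)

  module Residues {k} (R : Fin k → Mat) where

    Residue : Mat → Set
    Residue M = ∃ λ r → (M ≡ₘ R r) ⊎ (negM M ≡ₘ R r)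

    residue? : ∀ M → Dec (Residue M)
    residue? M = any? λ r → (M ≡ₘ? R r) ⊎-dec (negM M ≡ₘ? R r)

    Residue-negM : ∀ {M} → Residue M → Residue (negM M)
    Residue-negM {M} (r , inj₁ M≡R) = r , inj₂ (subst (_≡ₘ R r) (sym (negM-involutive M)) M≡R)
    Residue-negM (r , inj₂ -M≡R) = r , inj₁ -M≡R

    Residue-≡ₘ : ∀ {M N} → M ≡ₘ N → Residue N → Residue M
    Residue-≡ₘ M≡N (r , inj₁ N≡R) = r , inj₁ (≡ₘ-trans M≡N N≡R)
    Residue-≡ₘ M≡N (r , inj₂ -N≡R) = r , inj₂ (≡ₘ-trans (≡ₘ-negM M≡N) -N≡R)

    Residue-⊗ : ∀ {M} B → (∀ r → Residue (R r ⊗ B)) → Residue M → Residue (M ⊗ B)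
    Residue-⊗ B closed (r , inj₁ M≡R) = Residue-≡ₘ (≡ₘ-⊗ʳ B M≡R) (closed r)
    Residue-⊗ {M} B closed (r , inj₂ -M≡R) =
      subst Residue (trans (cong negM (negM-⊗ M B)) (negM-involutive (M ⊗ B)))
        (Residue-negM (Residue-≡ₘ (≡ₘ-⊗ʳ B -M≡R) (closed r)))

    Gen⊆Residue : ∀ {n} {f : Fin n → Mat} → Residue I →
      (∀ r t → Residue (R r ⊗ f t) × Residue (R r ⊗ inv (f t))) → ∀ {M} → Gen (OneOf f) M → Residue M
    Gen⊆Residue I-residue closed gen-id = I-residue
    Gen⊆Residue I-residue closed (gen-mul gM (t , refl)) =
      Residue-⊗ _ (λ r → proj₁ (closed r t)) (Gen⊆Residue I-residue closed gM)
    Gen⊆Residue I-residue closed (gen-inv gM (t , refl)) =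
      Residue-⊗ _ (λ r → proj₂ (closed r t)) (Gen⊆Residue I-residue closed gM)
    Gen⊆Residue I-residue closed (gen-resp (inj₁ refl) gM) = Gen⊆Residue I-residue closed gM
    Gen⊆Residue I-residue closed (gen-resp {N = N} (inj₂ refl) gM) =
      subst Residue (negM-involutive N) (Residue-negM (Gen⊆Residue I-residue closed gM))

IsNormal-≐ : ∀ {H K} → H ≐ K → IsNormal K → IsNormal H
IsNormal-≐ H≐K K-normal {g} {h} u Hh = proj₂ (H≐K _) (K-normal {g} {h} u (proj₁ (H≐K h) Hh))

IsTopographical-≐ : ∀ {H K} → H ≐ K → IsTopographical K → IsTopographical H
IsTopographical-≐ {H} {K} H≐K K-topographical = record
  { S = S
  ; S⊆H = K⊆H ∘ S⊆H
  ; generates = generates ∘ H⊆K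
  ; injective = λ Hh Hh′ → injective (H⊆K Hh) (H⊆K Hh′)
  ; surjective = λ T sb → let (h , Kh , h≈T) = surjective T sb in h , K⊆H Kh , h≈T
  ; edges⇒adj = λ Hh Hh′ → edges⇒adj (H⊆K Hh) (H⊆K Hh′)
  ; adj⇒edges = λ Hh Hh′ → adj⇒edges (H⊆K Hh) (H⊆K Hh′)
  }
  where
  open IsTopographical K-topographical
  H⊆K : ∀ {M} → H M → K M
  H⊆K {M} = proj₁ (H≐K M)
  K⊆H : ∀ {M} → K M → H M
  K⊆H {M} = proj₂ (H≐K M)

module Topographical {H : Mat → Set} (H-subgroup : IsSubgroup H) (H-topographical : IsTopographical H) where
  open IsSubgroup H-subgroup
  open IsTopographical H-topographical

  stabiliser-trivial : ∀ {v} → H v → T₀ ≈T φ v → v ~ I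
  stabiliser-trivial {v} Hv T₀≈v = injective {v} {I} Hv has-id (≈T-sym T₀≈v)

  meets-coset : ∀ g → InΠ g → IsSuperbasis (φ g) → ∃ λ s → H (g ⊗ σ s)
  meets-coset g u sb = s , resp {h} {g ⊗ σ s} (quotient-~ g {h} {σ s} u g⁻¹h~σ) Hh
    where
    preimage : ∃ λ h → H h × φ h ≈T φ g
    preimage = surjective (φ g) sb
    h = proj₁ preimage
    Hh : H h
    Hh = proj₁ (proj₂ preimage)
    stabilising : ∃ λ s → (inv g ⊗ h) ~ σ s
    stabilising = stabiliser-enum {inv g ⊗ h} (≈T-relative g u (≈T-sym (proj₂ (proj₂ preimage))))
    s = proj₁ stabilising
    g⁻¹h~σ : (inv g ⊗ h) ~ σ s
    g⁻¹h~σ = proj₂ stabilising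

edges⇒adj-from : ∀ {H S : Mat → Set} → (∀ {h} → H h → InΠ h) → (∀ {s} → S s → Adj T₀ (φ s)) →
  ∀ {h h′} → H h → H h′ → CayleyEdge S h h′ → Adj (φ h) (φ h′)
edges⇒adj-from H⊆Π S-adjacent {h} {h′} Hh Hh′ (s , s∈S , inj₁ h′~hs) =
  Adj-resp {φ h} {φ h} {φ (h ⊗ s)} {φ h′} ≈T-refl (φ-resp {h ⊗ s} {h′} (~-sym {h′} h′~hs))
    (Adj-translate h {s} (H⊆Π {h} Hh) (S-adjacent s∈S))
edges⇒adj-from H⊆Π S-adjacent {h} {h′} Hh Hh′ (s , s∈S , inj₂ h~h′s) =
  Adj-sym {φ h′} {φ h} (Adj-resp {φ h′} {φ h′} {φ (h′ ⊗ s)} {φ h} ≈T-refl (φ-resp {h′ ⊗ s} {h} (~-sym {h} h~h′s))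
    (Adj-translate h′ {s} (H⊆Π {h′} Hh′) (S-adjacent s∈S)))

-- Certificates that Gen (OneOf gen) is normal and topographical; edge n is its element in the coset
-- γ n Σ, and these edges form the topographical generating set.
record Presentation : Set where
  field
    gen edge : Fin 3 → Mat
    gen∈Π : ∀ t → InΠ (gen t)
    elementary-normalises : ∀ e t →
      Gen (OneOf gen) (conj (elementary e) (gen t)) × Gen (OneOf gen) (conj (inv (elementary e)) (gen t))
    elementary-reached : ∀ e → ∃ λ h → Gen (OneOf gen) h × φ h ≈T φ (elementary e)
    stabiliser-free : ∀ s → Gen (OneOf gen) (σ s) → σ s ~ I
    edge∈K : ∀ n → Gen (OneOf gen) (edge n)
    edge-neighbour : ∀ n → φ (edge n) ≈T φ (γ n)
    gen∈⟨edge⟩ : ∀ t → Gen (OneOf edge) (gen t)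
    edge-conjugate : ∀ n → ∃ λ s → edge n ~ conj (σ s) (edge (# 2))

module Presented (𝒫 : Presentation) where
  open Presentation 𝒫

  K : Mat → Set
  K = Gen (OneOf gen)

  gen⊆Π : ∀ {s} → OneOf gen s → InΠ s
  gen⊆Π (t , refl) = gen∈Π t

  K-subgroup : IsSubgroup K
  K-subgroup = Gen-isSubgroup gen⊆Π

  open IsSubgroup K-subgroup

  K-normal : IsNormal K
  K-normal {g} {h} = normal-if-elementary-normalise elementary-normalise {g} {h}
    where
    open Normaliser K-subgroup
    elementary-normalise : ∀ e → Normalises (elementary e) × Normalises (inv (elementary e))
    elementary-normalise e =
      Gen-normalised (λ {s} → gen⊆Π {s}) {elementary e} (elementary∈Π e)
        (λ { (t , refl) → proj₁ (elementary-normalises e t) }) ,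
      Gen-normalised (λ {s} → gen⊆Π {s}) {inv (elementary e)} (InΠ-inv (elementary e) (elementary∈Π e))
        (λ { (t , refl) → proj₂ (elementary-normalises e t) })

  K-stabiliser-trivial : ∀ {k} → K k → T₀ ≈T φ k → k ~ I
  K-stabiliser-trivial {k} Kk T₀≈k = ~-trans {k} {σ s} {I} k~σ (stabiliser-free s (gen-resp {M = k} {N = σ s} k~σ Kk))
    where
    stabilising : ∃ λ s → k ~ σ s
    stabilising = stabiliser-enum {k} T₀≈k
    s = proj₁ stabilising
    k~σ : k ~ σ s
    k~σ = proj₂ stabilising

  K-injective : ∀ {h h′} → K h → K h′ → φ h ≈T φ h′ → h ~ h′
  K-injective {h} {h′} Kh Kh′ h≈h′ = ~-sym {h′} {h} h′~h
    where
    h⁻¹h′~I : (inv h ⊗ h′) ~ I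
    h⁻¹h′~I = K-stabiliser-trivial {inv h ⊗ h′} (mul (has-inv Kh) Kh′) (≈T-relative h {h′} (⊆Π Kh) h≈h′)
    h′~h : h′ ~ h
    h′~h = subst (h′ ~_) (⊗-identityʳ h) (quotient-~ h {h′} {I} (⊆Π Kh) h⁻¹h′~I)

  edge-adjacent : ∀ n → Adj T₀ (φ (edge n))
  edge-adjacent n = Adj-resp {T₀} {T₀} {φ (γ n)} {φ (edge n)} ≈T-refl (≈T-sym (edge-neighbour n)) (γ-adjacent n)

  edge⊆Π : ∀ {s} → OneOf edge s → InΠ s
  edge⊆Π (n , refl) = ⊆Π (edge∈K n)

  K-generated-by-edges : ∀ {M} → K M → Gen (OneOf edge) M
  K-generated-by-edges = Gen-least {S = OneOf gen} {H = Gen (OneOf edge)} (Gen-isSubgroup (λ {s} → edge⊆Π {s}))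
    λ { (t , refl) → gen∈⟨edge⟩ t }

  K-surjective : ∀ T → IsSuperbasis T → ∃ λ h → K h × φ h ≈T T
  K-surjective T sb = reached (superbasis-realised T sb)
    where
    reached : (∃ λ M → InΠ M × φ M ≈T T) → ∃ λ h → K h × φ h ≈T T
    reached (M , u , M≈T) = h , proj₁ (proj₂ preimage) , ≈T-trans {φ h} {φ M} {T} (proj₂ (proj₂ preimage)) M≈T
      where
      preimage : ∃ λ h → K h × φ h ≈T φ M
      preimage = Orbit.transitive K-subgroup (λ {g} {h} → K-normal {g} {h}) elementary-reached {M} u
      h = proj₁ preimage

  K-edges⇒adj : ∀ {h h′} → K h → K h′ → CayleyEdge (OneOf edge) h h′ → Adj (φ h) (φ h′)
  K-edges⇒adj = edges⇒adj-from (λ {h} → ⊆Π {h}) λ { (n , refl) → edge-adjacent n }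

  K-adj⇒edges : ∀ {h h′} → K h → K h′ → Adj (φ h) (φ h′) → CayleyEdge (OneOf edge) h h′
  K-adj⇒edges {h} {h′} Kh Kh′ adj = edge n , (n , refl) , inj₁ h′~h·edge
    where
    Kk : K (inv h ⊗ h′)
    Kk = mul (has-inv Kh) Kh′
    neighbour : ∃ λ n → φ (inv h ⊗ h′) ≈T φ (γ n)
    neighbour = neighbour-enum {inv h ⊗ h′} (⊆Π Kk) (Adj-relative h (⊆Π Kh) adj)
    n = proj₁ neighbour
    k~edge : (inv h ⊗ h′) ~ edge n
    k~edge = K-injective {inv h ⊗ h′} {edge n} Kk (edge∈K n) (≈T-trans (proj₂ neighbour) (≈T-sym (edge-neighbour n)))
    h′~h·edge : h′ ~ (h ⊗ edge n)
    h′~h·edge = quotient-~ h {h′} {edge n} (⊆Π Kh) k~edge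

  K-topographical : IsTopographical K
  K-topographical = record
    { S = OneOf edge
    ; S⊆H = λ { (n , refl) → edge∈K n }
    ; generates = λ {M} → K-generated-by-edges {M}
    ; injective = λ {h} {h′} → K-injective {h} {h′}
    ; surjective = K-surjective
    ; edges⇒adj = λ {h} {h′} → K-edges⇒adj {h} {h′}
    ; adj⇒edges = λ {h} {h′} → K-adj⇒edges {h} {h′}
    }

  unique : ∀ {H} → IsSubgroup H → IsNormal H → IsTopographical H → H (edge (# 2)) → H ≐ K
  unique {H} H-subgroup H-normal H-topographical H∋root M = H⊆K , K⊆H
    where
    open IsSubgroup H-subgroup renaming (⊆Π to H⊆Π; resp to H-resp; has-id to H∋I)
    open IsTopographical H-topographical
    H∋edge : ∀ n → H (edge n)
    H∋edge n = H-resp {conj (σ s) (edge (# 2))} {edge n} (~-sym {edge n} (proj₂ (edge-conjugate n)))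
      (H-normal {σ s} (σ∈Π s) H∋root)
      where s = proj₁ (edge-conjugate n)
    S⊆K : ∀ {s} → S s → K s
    S⊆K {s} s∈S = gen-resp {M = edge n} {N = s} (~-sym {s} s~edge) (edge∈K n)
      where
      Hs : H s
      Hs = S⊆H s∈S
      neighbour : ∃ λ n → φ s ≈T φ (γ n)
      neighbour = neighbour-enum {s} (H⊆Π Hs) (edges⇒adj H∋I Hs (s , s∈S , inj₁ (inj₁ (sym (⊗-identityˡ s)))))
      n = proj₁ neighbour
      s~edge : s ~ edge n
      s~edge = injective {s} {edge n} Hs (H∋edge n) (≈T-trans (proj₂ neighbour) (≈T-sym (edge-neighbour n)))
    H⊆K : H M → K M
    H⊆K HM = Gen-least K-subgroup S⊆K (generates HM)
    K⊆H : K M → H M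
    K⊆H = Gen-least H-subgroup λ { (t , refl) → Gen-least H-subgroup (λ { (n , refl) → H∋edge n }) (gen∈⟨edge⟩ t) }

  normal-topographical : ∀ {H} → H ≐ K → IsNormal H × IsTopographical H
  normal-topographical {H} H≐K =
    (λ {g} {h} → IsNormal-≐ {H} {K} H≐K (λ {g′} {h′} → K-normal {g′} {h′}) {g} {h}) , IsTopographical-≐ H≐K K-topographical

-- Words are lists of generator indices: every γ i and ρ i is an involution in Π, so no inverse
-- letters are needed.
γ-presentation : Presentation
γ-presentation = record
  { gen = γ
  ; edge = γ
  ; gen∈Π = from-yes (all? λ t → InΠ? (γ t))
  ; elementary-normalises = λ e t →
      Gen-word γ (conj-word e t) (conj-checked e t) , Gen-word γ (conj⁻¹-word e t) (conj⁻¹-checked e t)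
  ; elementary-reached = λ e → product γ (reach-word e) , Gen-word γ (reach-word e) ~-refl , reach-checked e
  ; stabiliser-free = λ s Kσ → residue-free s (Gen⊆Residue (from-yes (residue? I)) residues-closed Kσ)
  ; edge∈K = λ n → Gen-generator (n , refl)
  ; edge-neighbour = λ n → ≈T-refl
  ; gen∈⟨edge⟩ = λ t → Gen-generator (t , refl)
  ; edge-conjugate = from-yes (all? λ n → any? λ s → γ n ~? conj (σ s) γ₃)
  }
  where
  conj-word : Fin 3 → Fin 3 → List (Fin 3)
  conj-word e t = lookup (lookup
    ( ((# 0 ∷ # 1 ∷ # 0 ∷ []) ∷ (# 0 ∷ # 2 ∷ # 0 ∷ []) ∷ (# 0 ∷ []) ∷ [])
    ∷ ((# 1 ∷ []) ∷ (# 0 ∷ []) ∷ (# 2 ∷ []) ∷ [])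
    ∷ ((# 2 ∷ # 1 ∷ # 2 ∷ []) ∷ (# 2 ∷ # 0 ∷ # 2 ∷ []) ∷ (# 2 ∷ []) ∷ [])
    ∷ []) e) t
  conj⁻¹-word : Fin 3 → Fin 3 → List (Fin 3)
  conj⁻¹-word zero = lookup ((# 2 ∷ []) ∷ (# 2 ∷ # 0 ∷ # 2 ∷ []) ∷ (# 2 ∷ # 1 ∷ # 2 ∷ []) ∷ [])
  conj⁻¹-word e = conj-word e
  conj-checked : ∀ e t → product γ (conj-word e t) ~ conj (elementary e) (γ t)
  conj-checked = from-yes (all? λ e → all? λ t → product γ (conj-word e t) ~? conj (elementary e) (γ t))
  conj⁻¹-checked : ∀ e t → product γ (conj⁻¹-word e t) ~ conj (inv (elementary e)) (γ t)
  conj⁻¹-checked = from-yes (all? λ e → all? λ t → product γ (conj⁻¹-word e t) ~? conj (inv (elementary e)) (γ t))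
  reach-word : Fin 3 → List (Fin 3)
  reach-word = lookup ((# 0 ∷ []) ∷ [] ∷ (# 2 ∷ []) ∷ [])
  reach-checked : ∀ e → φ (product γ (reach-word e)) ≈T φ (elementary e)
  reach-checked = from-yes (all? λ e → φ (product γ (reach-word e)) ≈T? φ (elementary e))
  -- Modulo 3, G lands in the quaternion group {±I, ±γ₁, ±γ₂, ±γ₃} of SL₂(𝔽₃).
  residue : Fin 4 → Mat
  residue = lookup (I ∷ γ₁ ∷ γ₂ ∷ γ₃ ∷ [])
  open Congruence (+ 3)
  open Residues residue
  residues-closed : ∀ r t → Residue (residue r ⊗ γ t) × Residue (residue r ⊗ inv (γ t))
  residues-closed = from-yes (all? λ r → all? λ t → residue? (residue r ⊗ γ t) ×-dec residue? (residue r ⊗ inv (γ t)))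
  residue-free : ∀ s → Residue (σ s) → σ s ~ I
  residue-free = from-yes (all? λ s → residue? (σ s) →-dec (σ s ~? I))

ρ₃′ : Mat
ρ₃′ = mat (+ 1) (+ 0) (+ 2) -1ℤ

ρ : Fin 3 → Mat
ρ = lookup (ρ₁ ∷ ρ₂ ∷ ρ₃ ∷ [])

ρ-presentation : Presentation
ρ-presentation = record
  { gen = ρ
  ; edge = edge
  ; gen∈Π = from-yes (all? λ t → InΠ? (ρ t))
  ; elementary-normalises = λ e t →
      Gen-word ρ (conj-word e t) (conj-checked e t) , Gen-word ρ (conj⁻¹-word e t) (conj⁻¹-checked e t)
  ; elementary-reached = λ e → product ρ (reach-word e) , Gen-word ρ (reach-word e) ~-refl , reach-checked e
  ; stabiliser-free = λ s Kσ → residue-free s (Gen⊆Residue (from-yes (residue? I)) residues-closed Kσ)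
  ; edge∈K = λ n → Gen-word ρ (edge-word n) (edge-checked n)
  ; edge-neighbour = from-yes (all? λ n → φ (edge n) ≈T? φ (γ n))
  ; gen∈⟨edge⟩ = λ t → Gen-word edge (gen-word t) (gen-checked t)
  ; edge-conjugate = from-yes (all? λ n → any? λ s → edge n ~? conj (σ s) ρ₁)
  }
  where
  edge : Fin 3 → Mat
  edge = lookup (ρ₂ ∷ ρ₃′ ∷ ρ₁ ∷ [])
  conj-word : Fin 3 → Fin 3 → List (Fin 3)
  conj-word e t = lookup (lookup
    ( ((# 1 ∷ []) ∷ (# 1 ∷ # 0 ∷ # 1 ∷ []) ∷ (# 0 ∷ # 2 ∷ # 0 ∷ []) ∷ [])
    ∷ ((# 0 ∷ []) ∷ (# 0 ∷ # 2 ∷ # 0 ∷ []) ∷ (# 0 ∷ # 1 ∷ # 0 ∷ []) ∷ [])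
    ∷ ((# 0 ∷ []) ∷ (# 0 ∷ # 1 ∷ # 0 ∷ []) ∷ (# 0 ∷ # 2 ∷ # 0 ∷ []) ∷ [])
    ∷ []) e) t
  conj⁻¹-word : Fin 3 → Fin 3 → List (Fin 3)
  conj⁻¹-word zero = lookup ((# 0 ∷ # 1 ∷ # 0 ∷ []) ∷ (# 0 ∷ []) ∷ (# 0 ∷ # 1 ∷ # 0 ∷ # 2 ∷ # 0 ∷ # 1 ∷ # 0 ∷ []) ∷ [])
  conj⁻¹-word e = conj-word e
  conj-checked : ∀ e t → product ρ (conj-word e t) ~ conj (elementary e) (ρ t)
  conj-checked = from-yes (all? λ e → all? λ t → product ρ (conj-word e t) ~? conj (elementary e) (ρ t))
  conj⁻¹-checked : ∀ e t → product ρ (conj⁻¹-word e t) ~ conj (inv (elementary e)) (ρ t)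
  conj⁻¹-checked = from-yes (all? λ e → all? λ t → product ρ (conj⁻¹-word e t) ~? conj (inv (elementary e)) (ρ t))
  reach-word : Fin 3 → List (Fin 3)
  reach-word = lookup ((# 1 ∷ []) ∷ [] ∷ (# 0 ∷ []) ∷ [])
  reach-checked : ∀ e → φ (product ρ (reach-word e)) ≈T φ (elementary e)
  reach-checked = from-yes (all? λ e → φ (product ρ (reach-word e)) ≈T? φ (elementary e))
  edge-word : Fin 3 → List (Fin 3)
  edge-word = lookup ((# 1 ∷ []) ∷ (# 0 ∷ # 2 ∷ # 0 ∷ []) ∷ (# 0 ∷ []) ∷ [])
  edge-checked : ∀ n → product ρ (edge-word n) ~ edge n
  edge-checked = from-yes (all? λ n → product ρ (edge-word n) ~? edge n)
  gen-word : Fin 3 → List (Fin 3)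
  gen-word = lookup ((# 2 ∷ []) ∷ (# 0 ∷ []) ∷ (# 2 ∷ # 1 ∷ # 2 ∷ []) ∷ [])
  gen-checked : ∀ t → product edge (gen-word t) ~ ρ t
  gen-checked = from-yes (all? λ t → product edge (gen-word t) ~? ρ t)
  residue : Fin 1 → Mat
  residue _ = I
  open Congruence (+ 2)
  open Residues residue
  residues-closed : ∀ r t → Residue (residue r ⊗ ρ t) × Residue (residue r ⊗ inv (ρ t))
  residues-closed = from-yes (all? λ r → all? λ t → residue? (residue r ⊗ ρ t) ×-dec residue? (residue r ⊗ inv (ρ t)))
  residue-free : ∀ s → Residue (σ s) → σ s ~ I
  residue-free = from-yes (all? λ s → residue? (σ s) →-dec (σ s ~? I))

G≐⟨γ⟩ : G ≐ Gen (OneOf γ)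
G≐⟨γ⟩ = Gen-≐ Sγ⊆ ⊆Sγ
  where
  Sγ⊆ : ∀ {s} → Sγ s → OneOf γ s
  Sγ⊆ (inj₁ e) = zero , e
  Sγ⊆ (inj₂ (inj₁ e)) = suc zero , e
  Sγ⊆ (inj₂ (inj₂ e)) = suc (suc zero) , e
  ⊆Sγ : ∀ {s} → OneOf γ s → Sγ s
  ⊆Sγ (zero , e) = inj₁ e
  ⊆Sγ (suc zero , e) = inj₂ (inj₁ e)
  ⊆Sγ (suc (suc zero) , e) = inj₂ (inj₂ e)

P≐⟨ρ⟩ : P ≐ Gen (OneOf ρ)
P≐⟨ρ⟩ = Gen-≐ Sρ⊆ ⊆Sρ
  where
  Sρ⊆ : ∀ {s} → Sρ s → OneOf ρ s
  Sρ⊆ (inj₁ e) = zero , e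
  Sρ⊆ (inj₂ (inj₁ e)) = suc zero , e
  Sρ⊆ (inj₂ (inj₂ e)) = suc (suc zero) , e
  ⊆Sρ : ∀ {s} → OneOf ρ s → Sρ s
  ⊆Sρ (zero , e) = inj₁ e
  ⊆Sρ (suc zero , e) = inj₂ (inj₁ e)
  ⊆Sρ (suc (suc zero) , e) = inj₂ (inj₂ e)

-- c times a Σ-conjugate of c fixes T₀ without being trivial; a normal topographical group cannot contain c.
Excluded : Mat → Set
Excluded c = ∃ λ t → T₀ ≈T φ (c ⊗ conj (σ t) c) × ¬ ((c ⊗ conj (σ t) c) ~ I)

coset-γ₃-cases : ∀ s → ((γ₃ ⊗ σ s) ~ γ₃) ⊎ ((γ₃ ⊗ σ s) ~ ρ₁) ⊎ Excluded (γ₃ ⊗ σ s)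
coset-γ₃-cases = from-yes (all? λ s → let c = γ₃ ⊗ σ s in
  (c ~? γ₃) ⊎-dec (c ~? ρ₁) ⊎-dec (any? λ t → (T₀ ≈T? φ (c ⊗ conj (σ t) c)) ×-dec ¬? ((c ⊗ conj (σ t) c) ~? I)))

theorem10p3 : (H : Mat → Set) → IsSubgroup H →
    ((IsNormal H × IsTopographical H) → ((H ≐ G) ⊎ (H ≐ P))) ×
    (((H ≐ G) ⊎ (H ≐ P)) → (IsNormal H × IsTopographical H))
theorem10p3 H H-subgroup = necessary , sufficient
  where
  open IsSubgroup H-subgroup
  necessary : IsNormal H × IsTopographical H → (H ≐ G) ⊎ (H ≐ P)
  necessary (H-normal , H-topographical) = classify (coset-γ₃-cases s)
    where
    open Topographical H-subgroup H-topographical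
    root : ∃ λ s → H (γ₃ ⊗ σ s)
    root = meets-coset γ₃ (inj₁ refl) (from-yes (IsSuperbasis? (φ γ₃)))
    s = proj₁ root
    γ₃σ = γ₃ ⊗ σ s
    unique : ∀ 𝒫 → H (Presentation.edge 𝒫 (# 2)) → H ≐ Presented.K 𝒫
    unique 𝒫 = Presented.unique 𝒫 H-subgroup (λ {g} {h} → H-normal {g} {h}) H-topographical
    classify : (γ₃σ ~ γ₃) ⊎ (γ₃σ ~ ρ₁) ⊎ Excluded γ₃σ → (H ≐ G) ⊎ (H ≐ P)
    classify (inj₁ γ₃σ~γ₃) =
      inj₁ (≐-trans (unique γ-presentation (resp {γ₃σ} γ₃σ~γ₃ (proj₂ root))) (≐-sym G≐⟨γ⟩))
    classify (inj₂ (inj₁ γ₃σ~ρ₁)) =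
      inj₂ (≐-trans (unique ρ-presentation (resp {γ₃σ} γ₃σ~ρ₁ (proj₂ root))) (≐-sym P≐⟨ρ⟩))
    classify (inj₂ (inj₂ (t , fixes-T₀ , nontrivial))) =
      ⊥-elim (nontrivial (stabiliser-trivial fixes-T₀-in-H fixes-T₀))
      where
      fixes-T₀-in-H : H (γ₃σ ⊗ conj (σ t) γ₃σ)
      fixes-T₀-in-H = mul (proj₂ root) (H-normal {σ t} {γ₃σ} (σ∈Π t) (proj₂ root))
  sufficient : (H ≐ G) ⊎ (H ≐ P) → IsNormal H × IsTopographical H
  sufficient (inj₁ H≐G) = Presented.normal-topographical γ-presentation (≐-trans H≐G G≐⟨γ⟩)
  sufficient (inj₂ H≐P) = Presented.normal-topographical ρ-presentation (≐-trans H≐P P≐⟨ρ⟩)
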